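{- Let $n\geq 2$. For integers $b\geq 1$, $k\geq 0$ with $2b+k=n$ and $T\in \mathrm{SYT}^{+k}(2\times b)$, define the word $\alpha(T)$ as follows. Let $A_1,\dots,A_b$ be the sets in the top-row cells and $B_1,\dots,B_b$ the sets in the bottom-row cells of $T$, from left to right (so $n\in B_b$). Put $B_i'=B_i$ for $i<b$ and $B_b'=B_b\setminus\{n\}$. Then $\alpha(T)$ is the concatenation, for $i=1,\dots,b$ in order, of: the elements of $A_i\setminus\{\max A_i\}$ in increasing order, followed by the elements of $B_i'$ in increasing order, followed by $\max A_i$. Then: (1) $\alpha$ is a bijection from $\bigsqcup_{b\geq 1,\,k\geq 0,\,2b+k=n}\mathrm{SYT}^{+k}(2\times b)$ to the set of $321$-avoiding permutations of $[n-1]$; (2) the entries of the top row of $T$, listed in increasing order, are exactly the right-to-left minima of $\alpha(T)$ read from left to right; (3) if $T$ has $b$ columns, then $\alpha(T)$ has exactly $b-1$ inner valleys.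
   Context: For a partition $\lambda$ of $m$ (Ferrers diagram in English convention) and $k\geq 0$, $\mathrm{SYT}^{+k}(\lambda)$ is the set of fillings $S$ of the cells of $\lambda$ by nonempty sets of positive integers such that the sets form a set partition of $[m+k]$, and whenever $u\neq v$ are cells with $u$ weakly north and weakly west of $v$, $\max S(u)<\min S(v)$. The shape $2\times b$ has two rows of $b$ cells each. A permutation $\pi=\pi_1\cdots\pi_N$ is $321$-avoiding if there are no $i<j<l$ with $\pi_i>\pi_j>\pi_l$. A right-to-left minimum of $\pi$ is an entry $\pi_i$ with $\pi_i<\pi_j$ for all $j>i$. An inner valley of $\pi$ is an entry $\pi_j$ with $1<j<N$ and $\pi_{j-1}>\pi_j<\pi_{j+1}$. -}

module Defs where

open import Data.Nat using (ℕ; zero; suc; _+_; _*_; _∸_; _≤_; _<_; _≟_; _<ᵇ_)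
open import Data.Nat.Properties using (_<?_)
open import Data.Bool using (Bool; true; false; if_then_else_; _∧_)
open import Data.Fin as F using (Fin; toℕ)
open import Data.Fin.Subset using (Subset; _∈_; ⋃; Nonempty)
open import Data.Fin.Subset.Properties using (_∈?_)
open import Data.List using (List; []; _∷_; _++_; map; filter; concatMap; length; lookup; applyUpTo; allFin)
open import Data.Bool.ListAction using (and)
open import Data.Vec as V using (Vec)
open import Data.Product using (Σ; _×_; _,_)
open import Relation.Nullary using (¬_; ¬?)
open import Relation.Binary.PropositionalEquality using (_≡_; _≢_)

-- Elements of [n] = {1,…,n} are encoded by x : Fin n standing for toℕ x + 1.

-- Raw data of a filling of the 2 × b diagram by subsets of [n]:
-- top = (A_1,…,A_b), bot = (B_1,…,B_b).
record Tab (n : ℕ) : Set where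
  constructor mkTab
  field
    b   : ℕ
    k   : ℕ
    top : Vec (Subset n) b
    bot : Vec (Subset n) b
open Tab public

-- the set in the cell (row r, column c); row zero is the top row
cell : ∀ {n} (T : Tab n) → Fin 2 → Fin (b T) → Subset n
cell T F.zero c = V.lookup (top T) c
cell T (F.suc _) c = V.lookup (bot T) c

record IsSYT {n : ℕ} (T : Tab n) : Set where
  field
    b≥1      : 1 ≤ b T
    size     : 2 * b T + k T ≡ n
    nonempty : ∀ r c → Nonempty (cell T r c)
    covers   : ∀ (x : Fin n) → Σ (Fin 2) λ r → Σ (Fin (b T)) λ c → x ∈ cell T r c
    disjoint : ∀ (x : Fin n) r c r′ c′ → x ∈ cell T r c → x ∈ cell T r′ c′ →
               (r ≡ r′) × (c ≡ c′)
    increasing : ∀ r c r′ c′ → r F.≤ r′ → c F.≤ c′ → ¬ ((r ≡ r′) × (c ≡ c′)) →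
                 ∀ (x y : Fin n) → x ∈ cell T r c → y ∈ cell T r′ c′ → x F.< y

elems : ∀ {n} → Subset n → List ℕ
elems {n} p = map (λ x → suc (toℕ x)) (filter (λ x → x ∈? p) (allFin n))

dropLast : List ℕ → List ℕ
dropLast [] = []
dropLast (x ∷ []) = []
dropLast (x ∷ y ∷ xs) = x ∷ dropLast (y ∷ xs)

lastOf : List ℕ → List ℕ
lastOf [] = []
lastOf (x ∷ []) = x ∷ []
lastOf (x ∷ y ∷ xs) = lastOf (y ∷ xs)

B′ : ∀ {n} (T : Tab n) → Fin (b T) → List ℕ
B′ {n} T c with suc (toℕ c) ≟ b T
... | Relation.Nullary.yes _ = filter (λ x → ¬? (x ≟ n)) (elems (V.lookup (bot T) c))
... | Relation.Nullary.no _ = elems (V.lookup (bot T) c)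

α : ∀ {n} → Tab n → List ℕ
α T = concatMap (λ c → let A = elems (V.lookup (top T) c) in
                        dropLast A ++ B′ T c ++ lastOf A)
                (allFin (b T))

topEntries : ∀ {n} → Tab n → List ℕ
topEntries T = elems (⋃ (V.toList (top T)))

IsPerm : ℕ → List ℕ → Set
IsPerm m w = Data.List.Relation.Binary.Permutation.Propositional._↭_ w (applyUpTo suc m)
  where import Data.List.Relation.Binary.Permutation.Propositional

Avoids321 : List ℕ → Set
Avoids321 w = ∀ (i j l : Fin (length w)) → i F.< j → j F.< l →
  ¬ ((lookup w j < lookup w i) × (lookup w l < lookup w j))

rlMins : List ℕ → List ℕ
rlMins [] = []
rlMins (x ∷ xs) = if and (map (λ y → x <ᵇ y) xs) then x ∷ rlMins xs else rlMins xs

innerValleys : List ℕ → ℕ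
innerValleys (x ∷ y ∷ z ∷ rest) =
  (if (y <ᵇ x) ∧ (y <ᵇ z) then 1 else 0) + innerValleys (y ∷ z ∷ rest)
innerValleys _ = 0

-- Tag every letter of α(T) as top (from the first row) or bottom. Standardness of T makes the
-- tagged word well labelled: a top letter is smaller than every later letter, a bottom letter is
-- smaller than every later bottom letter, and every bottom letter has a smaller letter after it
-- (the largest entry of the top cell of its column). In a well-labelled word the top letters are
-- exactly the right-to-left minima, so the tags are determined by the word. A pattern x > y > z
-- cannot occur, since x would have to be a bottom letter and then y a top letter, smaller than z.
-- Conversely, tagging the right-to-left minima of a 321-avoiding permutation yields a well-labelled
-- word. Cutting a well-labelled word after every top letter that follows a bottom letter gives back
-- the columns of T (with n restored to the last bottom cell), which inverts α; the inner valleys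
-- are exactly the top letters closing a column other than the last.

module Submission where

open import Defs
open import Data.Bool using (Bool; true; false; if_then_else_; _∧_; not; T)
open import Data.Bool.Properties using (∧-identityʳ; ∧-zeroʳ)
open import Data.Bool.ListAction using (and)
open import Data.Empty using (⊥; ⊥-elim)
open import Data.Fin as F using (Fin; toℕ)
import Data.Fin.Properties as FinP
open import Data.Fin.Subset using (Subset; ⋃; Nonempty) renaming (_∈_ to _∈ₛ_)
import Data.Fin.Subset.Properties as SubsetP
open import Data.List using (List; []; _∷_; _++_; _∷ʳ_; [_]; map; filter; concat; tabulate; length; lookup; null; applyUpTo; allFin)
open import Data.List.Properties
  using (++-assoc; ++-identityʳ; map-++; length-++; map-tabulate; length-tabulate; tabulate-lookup; tabulate-cong;
         length-applyUpTo; filter-all; filter-accept; filter-reject; ∷-injective)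
open import Data.List.Membership.Propositional using (_∈_)
import Data.List.Membership.Propositional.Properties as ∈P
open import Data.List.Membership.Propositional.Properties.WithK using (unique∧set⇒bag)
open import Data.List.Relation.Binary.BagAndSetEquality using (∼bag⇒↭)
open import Data.List.Relation.Binary.Disjoint.Propositional using (Disjoint)
open import Data.List.Relation.Binary.Permutation.Propositional using (_↭_; ↭-sym; ↭-trans; ↭-reflexive; ↭⇒↭ₛ)
import Data.List.Relation.Binary.Permutation.Propositional.Properties as ↭P
import Data.List.Relation.Binary.Permutation.Setoid.Properties as PermutationₛP
open import Data.List.Relation.Unary.All as All using (All; []; _∷_)
import Data.List.Relation.Unary.All.Properties as AllP
open import Data.List.Relation.Unary.AllPairs as AllPairs using (AllPairs; []; _∷_)
import Data.List.Relation.Unary.AllPairs.Properties as AllPairsP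
open import Data.List.Relation.Unary.Any as Any using (Any; here; there)
import Data.List.Relation.Unary.Any.Properties as AnyP
open import Data.List.Relation.Unary.Unique.Propositional using (Unique)
import Data.List.Relation.Unary.Unique.Propositional.Properties as UniqueP
open import Data.Nat using (ℕ; suc; _+_; _*_; _∸_; _<_; _≤_; _<ᵇ_; _≟_; z≤n; s≤s; s<s⁻¹)
open import Data.Nat.Properties
open import Data.List.Membership.DecPropositional _≟_ using (_∈?_)
open import Data.Product using (Σ; ∃; _×_; _,_; proj₁; proj₂)
open import Data.Sum as Sum using (_⊎_; inj₁; inj₂; [_,_]′)
open import Data.Unit using (⊤; tt)
open import Data.Vec as Vec using (Vec)
import Data.Vec.Properties as VecP
open import Function using (_∘_)
open import Function.Bundles using (mk⇔)
open import Relation.Binary using (tri<; tri≈; tri>)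
open import Relation.Binary.PropositionalEquality hiding ([_])
open import Relation.Binary.PropositionalEquality.Properties using (setoid)
open import Relation.Nullary using (¬_; ¬?; Dec; yes; no; does; contradiction)

-- Labelled words

isLeast : ℕ → List ℕ → Bool
isLeast x xs = and (map (x <ᵇ_) xs)

<ᵇ-true : ∀ {x y} → x < y → (x <ᵇ y) ≡ true
<ᵇ-true {x} {y} x<y with x <ᵇ y | <⇒<ᵇ x<y
... | true | _ = refl

<ᵇ-false : ∀ {x y} → y < x → (x <ᵇ y) ≡ false
<ᵇ-false {x} {y} y<x with x <ᵇ y in eq
... | false = refl
... | true = ⊥-elim (<-asym y<x (<ᵇ⇒< x y (subst T (sym eq) tt)))

isLeast-true : ∀ {x} xs → All (x <_) xs → isLeast x xs ≡ true
isLeast-true [] [] = refl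
isLeast-true (y ∷ ys) (x<y ∷ h) rewrite <ᵇ-true x<y = isLeast-true ys h

isLeast-false : ∀ {x} xs → Any (_< x) xs → isLeast x xs ≡ false
isLeast-false (y ∷ ys) (here y<x) rewrite <ᵇ-false y<x = refl
isLeast-false {x} (y ∷ ys) (there h) = trans (cong ((x <ᵇ y) ∧_) (isLeast-false ys h)) (∧-zeroʳ (x <ᵇ y))

isLeast-true⁻ : ∀ x xs → isLeast x xs ≡ true → All (x <_) xs
isLeast-true⁻ x [] _ = []
isLeast-true⁻ x (y ∷ ys) e with x <ᵇ y in eq
... | true = <ᵇ⇒< x y (subst T (sym eq) tt) ∷ isLeast-true⁻ x ys e

isLeast-false⁻ : ∀ x xs → isLeast x xs ≡ false → Any (_≤ x) xs
isLeast-false⁻ x (y ∷ ys) e with x <ᵇ y in eq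
... | true = there (isLeast-false⁻ x ys e)
... | false = here (≮⇒≥ (λ x<y → contradiction (trans (sym (<ᵇ-true x<y)) eq) λ ()))

-- A letter tagged true is meant to be a right-to-left minimum (an entry of the top row).
Letter : Set
Letter = ℕ × Bool

LWord : Set
LWord = List Letter

letters : LWord → List ℕ
letters = map proj₁

topLetters : LWord → List ℕ
topLetters [] = []
topLetters ((x , true) ∷ r) = x ∷ topLetters r
topLetters ((x , false) ∷ r) = topLetters r

label : List ℕ → LWord
label [] = []
label (x ∷ xs) = (x , isLeast x xs) ∷ label xs

CanPrecede : Letter → Letter → Set
CanPrecede (x , true) (y , _) = x < y
CanPrecede (x , false) (y , true) = ⊤
CanPrecede (x , false) (y , false) = x < y

Below : ℕ → Letter → Set
Below x q = proj₁ q < x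

BottomsNotLeast : LWord → Set
BottomsNotLeast [] = ⊤
BottomsNotLeast ((x , true) ∷ r) = BottomsNotLeast r
BottomsNotLeast ((x , false) ∷ r) = Any (Below x) r × BottomsNotLeast r

WellLabelled : LWord → Set
WellLabelled L = AllPairs CanPrecede L × BottomsNotLeast L

BottomsNotLeast-tail : ∀ p L → BottomsNotLeast (p ∷ L) → BottomsNotLeast L
BottomsNotLeast-tail (x , true) L h = h
BottomsNotLeast-tail (x , false) L h = proj₂ h

WellLabelled-tail : ∀ {p L} → WellLabelled (p ∷ L) → WellLabelled L
WellLabelled-tail {p} {L} (_ ∷ ap , bn) = ap , BottomsNotLeast-tail p L bn

isLeast-tag : ∀ p r → All (CanPrecede p) r → BottomsNotLeast (p ∷ r) → isLeast (proj₁ p) (letters r) ≡ proj₂ p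
isLeast-tag (x , true) r h _ = isLeast-true (letters r) (AllP.map⁺ h)
isLeast-tag (x , false) r _ (below , _) = isLeast-false (letters r) (AnyP.map⁺ below)

label-letters : ∀ L → WellLabelled L → label (letters L) ≡ L
label-letters [] _ = refl
label-letters (p ∷ L) (h ∷ ap , bn) =
  cong₂ _∷_ (cong (proj₁ p ,_) (isLeast-tag p L h bn))
            (label-letters L (ap , BottomsNotLeast-tail p L bn))

letters-label : ∀ w → letters (label w) ≡ w
letters-label [] = refl
letters-label (x ∷ xs) = cong (x ∷_) (letters-label xs)

rlMins-letters : ∀ L → WellLabelled L → rlMins (letters L) ≡ topLetters L
rlMins-letters [] _ = refl
rlMins-letters ((x , true) ∷ L) (h ∷ ap , bn)
  rewrite isLeast-tag (x , true) L h bn = cong (x ∷_) (rlMins-letters L (ap , bn))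
rlMins-letters ((x , false) ∷ L) (h ∷ ap , bn)
  rewrite isLeast-tag (x , false) L h bn = rlMins-letters L (ap , proj₂ bn)

lookupLetter : (L : LWord) → Fin (length (letters L)) → Letter
lookupLetter (p ∷ L) F.zero = p
lookupLetter (p ∷ L) (F.suc i) = lookupLetter L i

lookup-letters : ∀ L i → lookup (letters L) i ≡ proj₁ (lookupLetter L i)
lookup-letters (p ∷ L) F.zero = refl
lookup-letters (p ∷ L) (F.suc i) = lookup-letters L i

All-lookupLetter : ∀ {P : Letter → Set} {L} → All P L → ∀ i → P (lookupLetter L i)
All-lookupLetter (h ∷ hs) F.zero = h
All-lookupLetter (h ∷ hs) (F.suc i) = All-lookupLetter hs i

AllPairs-lookupLetter : ∀ {R : Letter → Letter → Set} {L} → AllPairs R L →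
  ∀ i j → i F.< j → R (lookupLetter L i) (lookupLetter L j)
AllPairs-lookupLetter (h ∷ hs) F.zero (F.suc j) _ = All-lookupLetter h j
AllPairs-lookupLetter (h ∷ hs) (F.suc i) (F.suc j) (s≤s i<j) = AllPairs-lookupLetter hs i j i<j

CanPrecede-no321 : ∀ p q r → CanPrecede p q → CanPrecede q r →
  ¬ (proj₁ q < proj₁ p × proj₁ r < proj₁ q)
CanPrecede-no321 (x , true) q r p<q _ (q<p , _) = <-asym p<q q<p
CanPrecede-no321 (x , false) (y , true) r _ q<r (_ , r<q) = <-asym q<r r<q
CanPrecede-no321 (x , false) (y , false) r p<q _ (q<p , _) = <-asym p<q q<p

avoids321-letters : ∀ L → AllPairs CanPrecede L → Avoids321 (letters L)
avoids321-letters (p ∷ L) (h ∷ hs) F.zero (F.suc j) (F.suc l) _ (s≤s j<l)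
  rewrite lookup-letters L j | lookup-letters L l =
  CanPrecede-no321 p (lookupLetter L j) (lookupLetter L l)
    (All-lookupLetter h j) (AllPairs-lookupLetter hs j l j<l)
avoids321-letters (p ∷ L) (h ∷ hs) (F.suc i) (F.suc j) (F.suc l) (s≤s i<j) (s≤s j<l) =
  avoids321-letters L hs i j l i<j j<l

tagValleys : Bool → LWord → ℕ
tagValleys _ [] = 0
tagValleys prev ((_ , t) ∷ r) = (if not prev ∧ t ∧ not (null r) then 1 else 0) + tagValleys t r

top-below : ∀ {x y L} → All (CanPrecede (y , true)) L → Any (Below x) ((y , true) ∷ L) → y < x
top-below _ (here y<x) = y<x
top-below y<L (there z<x) = let (y<z , z<x) = All.lookupAny y<L z<x in <-trans y<z z<x

isValley-tags : ∀ p q o r → WellLabelled (p ∷ q ∷ o ∷ r) →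
  ((proj₁ q <ᵇ proj₁ p) ∧ (proj₁ q <ᵇ proj₁ o)) ≡ not (proj₂ p) ∧ proj₂ q
isValley-tags (x , true) q o r ((p<q ∷ _) ∷ _ , _) rewrite <ᵇ-false p<q = refl
isValley-tags (x , false) (y , false) o r ((p<q ∷ _) ∷ _ , _) rewrite <ᵇ-false p<q = refl
isValley-tags (x , false) (y , true) o r ((_ ∷ _) ∷ (y<o ∷ y<r) ∷ _ , (below , _))
  rewrite <ᵇ-true y<o | <ᵇ-true (top-below (y<o ∷ y<r) below) = refl

innerValleys-cons : ∀ x s L → WellLabelled ((x , s) ∷ L) →
  innerValleys (x ∷ letters L) ≡ tagValleys s L
innerValleys-cons x s [] _ = refl
innerValleys-cons x s ((y , t) ∷ []) _ rewrite ∧-zeroʳ t | ∧-zeroʳ (not s) = refl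
innerValleys-cons x s ((y , t) ∷ q ∷ r) wl =
  cong₂ _+_ (cong (λ v → if v then 1 else 0)
                  (trans (isValley-tags (x , s) (y , t) q r wl) (cong (not s ∧_) (sym (∧-identityʳ t)))))
            (innerValleys-cons y t (q ∷ r) (WellLabelled-tail wl))

innerValleys-letters : ∀ L → WellLabelled L → innerValleys (letters L) ≡ tagValleys true L
innerValleys-letters [] _ = refl
innerValleys-letters ((x , s) ∷ L) wl = innerValleys-cons x s L wl

label-All : ∀ {x} xs → All (x <_) xs → All (CanPrecede (x , true)) (label xs)
label-All [] [] = []
label-All (y ∷ ys) (x<y ∷ h) = x<y ∷ label-All ys h

label-Any : ∀ {x} xs → Any (_< x) xs → Any (Below x) (label xs)
label-Any (y ∷ ys) (here y<x) = here y<x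
label-Any (y ∷ ys) (there h) = there (label-Any ys h)

Any-≤-≢⇒< : ∀ {y} {xs : List ℕ} → All (y ≢_) xs → Any (_≤ y) xs → Any (_< y) xs
Any-≤-≢⇒< (y≢x ∷ _) (here x≤y) = here (≤∧≢⇒< x≤y (≢-sym y≢x))
Any-≤-≢⇒< (_ ∷ h) (there x≤y) = there (Any-≤-≢⇒< h x≤y)

-- a non-least letter x may precede a later non-least letter y only if x < y: otherwise x y z,
-- with z < y after y, would be a 321 pattern
label-bottom-CanPrecede : ∀ x xs → All (x ≢_) xs → Unique xs →
  (∀ j l → j F.< l → ¬ (lookup xs j < x × lookup xs l < lookup xs j)) →
  All (CanPrecede (x , false)) (label xs)
label-bottom-CanPrecede x [] _ _ _ = []
label-bottom-CanPrecede x (y ∷ ys) (x≢y ∷ x≢ys) (y∉ys ∷ u) no321 =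
  head ∷ label-bottom-CanPrecede x ys x≢ys u (λ j l j<l → no321 (F.suc j) (F.suc l) (s≤s j<l))
  where
  head : CanPrecede (x , false) (y , isLeast y ys)
  head with isLeast y ys in e
  ... | true = tt
  ... | false with Any-≤-≢⇒< y∉ys (isLeast-false⁻ y ys e)
  ... | z<y with <-cmp x y
  ... | tri< x<y _ _ = x<y
  ... | tri≈ _ x≡y _ = ⊥-elim (x≢y x≡y)
  ... | tri> _ _ y<x = ⊥-elim (no321 F.zero (F.suc (Any.index z<y)) (s≤s z≤n) (y<x , AnyP.lookup-index z<y))

label-wellLabelled : ∀ w → Unique w → Avoids321 w → WellLabelled (label w)
label-wellLabelled [] _ _ = [] , tt
label-wellLabelled (x ∷ xs) (x∉xs ∷ u) av with isLeast x xs in e | label-wellLabelled xs u av′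
  where
  av′ : Avoids321 xs
  av′ i j l i<j j<l = av (F.suc i) (F.suc j) (F.suc l) (s≤s i<j) (s≤s j<l)
... | true | (ap , bn) = label-All xs (isLeast-true⁻ x xs e) ∷ ap , bn
... | false | (ap , bn) =
  label-bottom-CanPrecede x xs x∉xs u (λ j l j<l → av F.zero (F.suc j) (F.suc l) (s≤s z≤n) (s≤s j<l)) ∷ ap ,
  label-Any xs (Any-≤-≢⇒< x∉xs (isLeast-false⁻ x xs e)) , bn

-- Columns as labelled words

NonEmpty : List ℕ → Set
NonEmpty [] = ⊥
NonEmpty (_ ∷ _) = ⊤

∷ʳ-nonEmpty : ∀ xs x → NonEmpty (xs ∷ʳ x)
∷ʳ-nonEmpty [] x = tt
∷ʳ-nonEmpty (_ ∷ _) x = tt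

dropLast++lastOf : ∀ xs → dropLast xs ++ lastOf xs ≡ xs
dropLast++lastOf [] = refl
dropLast++lastOf (x ∷ []) = refl
dropLast++lastOf (x ∷ y ∷ r) = cong (x ∷_) (dropLast++lastOf (y ∷ r))

lastOf-nonEmpty : ∀ xs → NonEmpty xs → ∃ λ m → lastOf xs ≡ [ m ]
lastOf-nonEmpty (x ∷ []) _ = x , refl
lastOf-nonEmpty (x ∷ y ∷ r) _ = lastOf-nonEmpty (y ∷ r) tt

dropLast-∷ʳ : ∀ xs x → dropLast (xs ∷ʳ x) ≡ xs
dropLast-∷ʳ [] x = refl
dropLast-∷ʳ (a ∷ []) x = refl
dropLast-∷ʳ (a ∷ b ∷ r) x = cong (a ∷_) (dropLast-∷ʳ (b ∷ r) x)

lastOf-∷ʳ : ∀ xs x → lastOf (xs ∷ʳ x) ≡ [ x ]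
lastOf-∷ʳ [] x = refl
lastOf-∷ʳ (a ∷ []) x = refl
lastOf-∷ʳ (a ∷ b ∷ r) x = lastOf-∷ʳ (b ∷ r) x

dropLast∷ʳlast : ∀ a {m} → lastOf a ≡ [ m ] → dropLast a ∷ʳ m ≡ a
dropLast∷ʳlast a lastOf≡m = trans (cong (dropLast a ++_) (sym lastOf≡m)) (dropLast++lastOf a)

module _ {P : ℕ → Set} where

  All-dropLast : ∀ xs → All P xs → All P (dropLast xs)
  All-dropLast xs h = AllP.++⁻ˡ (dropLast xs) (subst (All P) (sym (dropLast++lastOf xs)) h)

  All-lastOf : ∀ xs → All P xs → All P (lastOf xs)
  All-lastOf xs h = AllP.++⁻ʳ (dropLast xs) (subst (All P) (sym (dropLast++lastOf xs)) h)

  All-dropLast-lastOf : ∀ xs → All P (dropLast xs) → All P (lastOf xs) → All P xs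
  All-dropLast-lastOf xs h h′ = subst (All P) (dropLast++lastOf xs) (AllP.++⁺ h h′)

AllPairs-++⁻ : ∀ {A : Set} {R : A → A → Set} xs {ys} → AllPairs R (xs ++ ys) →
  AllPairs R xs × AllPairs R ys × All (λ x → All (R x) ys) xs
AllPairs-++⁻ [] h = [] , h , []
AllPairs-++⁻ (x ∷ xs) (h ∷ hs) =
  let (hxs , hys , hxys) = AllPairs-++⁻ xs hs in
  AllP.++⁻ˡ xs h ∷ hxs , hys , AllP.++⁻ʳ xs h ∷ hxys

Sorted : List ℕ → Set
Sorted = AllPairs _<_

_≺_ : List ℕ → List ℕ → Set
xs ≺ ys = All (λ x → All (x <_) ys) xs

Sorted-++⁻ : ∀ xs {ys} → Sorted (xs ++ ys) → Sorted xs × Sorted ys × xs ≺ ys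
Sorted-++⁻ = AllPairs-++⁻

-- A column (A , B′): the entries of its top cell and of its bottom cell, n removed.
Column : Set
Column = List ℕ × List ℕ

asTop asBottom : List ℕ → LWord
asTop = map (_, true)
asBottom = map (_, false)

labelColumn : Column → LWord
labelColumn (a , b) = asTop (dropLast a) ++ asBottom b ++ asTop (lastOf a)

labelColumns : List Column → LWord
labelColumns [] = []
labelColumns (c ∷ cs) = labelColumn c ++ labelColumns cs

columnWord : Column → List ℕ
columnWord (a , b) = dropLast a ++ b ++ lastOf a

letters-++ : ∀ L L′ → letters (L ++ L′) ≡ letters L ++ letters L′
letters-++ = map-++ proj₁

letters-asTop : ∀ xs → letters (asTop xs) ≡ xs
letters-asTop [] = refl
letters-asTop (x ∷ xs) = cong (x ∷_) (letters-asTop xs)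

letters-asBottom : ∀ xs → letters (asBottom xs) ≡ xs
letters-asBottom [] = refl
letters-asBottom (x ∷ xs) = cong (x ∷_) (letters-asBottom xs)

letters-labelColumn : ∀ c → letters (labelColumn c) ≡ columnWord c
letters-labelColumn (a , b) = begin
    letters (asTop (dropLast a) ++ asBottom b ++ asTop (lastOf a))
  ≡⟨ letters-++ (asTop (dropLast a)) _ ⟩
    letters (asTop (dropLast a)) ++ letters (asBottom b ++ asTop (lastOf a))
  ≡⟨ cong₂ _++_ (letters-asTop (dropLast a)) (letters-++ (asBottom b) _) ⟩
    dropLast a ++ letters (asBottom b) ++ letters (asTop (lastOf a))
  ≡⟨ cong (dropLast a ++_) (cong₂ _++_ (letters-asBottom b) (letters-asTop (lastOf a))) ⟩
    dropLast a ++ b ++ lastOf a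
  ∎
  where open ≡-Reasoning

letters-labelColumns : ∀ cs → letters (labelColumns cs) ≡ concat (map columnWord cs)
letters-labelColumns [] = refl
letters-labelColumns (c ∷ cs) =
  trans (letters-++ (labelColumn c) (labelColumns cs))
        (cong₂ _++_ (letters-labelColumn c) (letters-labelColumns cs))

topLetters-++ : ∀ L L′ → topLetters (L ++ L′) ≡ topLetters L ++ topLetters L′
topLetters-++ [] L′ = refl
topLetters-++ ((x , true) ∷ L) L′ = cong (x ∷_) (topLetters-++ L L′)
topLetters-++ ((x , false) ∷ L) L′ = topLetters-++ L L′

topLetters-asTop : ∀ xs → topLetters (asTop xs) ≡ xs
topLetters-asTop [] = refl
topLetters-asTop (x ∷ xs) = cong (x ∷_) (topLetters-asTop xs)

topLetters-asBottom : ∀ xs → topLetters (asBottom xs) ≡ []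
topLetters-asBottom [] = refl
topLetters-asBottom (x ∷ xs) = topLetters-asBottom xs

topLetters-labelColumns : ∀ cs → topLetters (labelColumns cs) ≡ concat (map proj₁ cs)
topLetters-labelColumns [] = refl
topLetters-labelColumns ((a , b) ∷ cs) =
  trans (topLetters-++ (labelColumn (a , b)) (labelColumns cs)) (cong₂ _++_ column (topLetters-labelColumns cs))
  where
  open ≡-Reasoning
  column : topLetters (labelColumn (a , b)) ≡ a
  column = begin
      topLetters (asTop (dropLast a) ++ asBottom b ++ asTop (lastOf a))
    ≡⟨ topLetters-++ (asTop (dropLast a)) _ ⟩
      topLetters (asTop (dropLast a)) ++ topLetters (asBottom b ++ asTop (lastOf a))
    ≡⟨ cong₂ _++_ (topLetters-asTop (dropLast a)) (topLetters-++ (asBottom b) _) ⟩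
      dropLast a ++ topLetters (asBottom b) ++ topLetters (asTop (lastOf a))
    ≡⟨ cong (dropLast a ++_) (cong₂ _++_ (topLetters-asBottom b) (topLetters-asTop (lastOf a))) ⟩
      dropLast a ++ lastOf a
    ≡⟨ dropLast++lastOf a ⟩
      a
    ∎

-- Reading a labelled word back into columns: a column ends at each top letter that follows a bottom letter.
finalColumn : List ℕ → List Column
finalColumn [] = []
finalColumn (a ∷ as) = [ (a ∷ as , []) ]

parseTop : List ℕ → LWord → List Column
parseBottom : List ℕ → List ℕ → LWord → List Column
parseTop acc [] = finalColumn acc
parseTop acc ((x , true) ∷ r) = parseTop (acc ∷ʳ x) r
parseTop acc ((x , false) ∷ r) = parseBottom acc [ x ] r
parseBottom acc bs [] = [ (acc , bs) ]
parseBottom acc bs ((x , false) ∷ r) = parseBottom acc (bs ∷ʳ x) r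
parseBottom acc bs ((x , true) ∷ r) = (acc ∷ʳ x , bs) ∷ parseTop [] r

parse : LWord → List Column
parse = parseTop []

parseTop-asTop : ∀ acc xs r → parseTop acc (asTop xs ++ r) ≡ parseTop (acc ++ xs) r
parseTop-asTop acc [] r = cong (λ acc′ → parseTop acc′ r) (sym (++-identityʳ acc))
parseTop-asTop acc (x ∷ xs) r =
  trans (parseTop-asTop (acc ∷ʳ x) xs r) (cong (λ acc′ → parseTop acc′ r) (++-assoc acc [ x ] xs))

parseBottom-asBottom : ∀ acc bs ys r → parseBottom acc bs (asBottom ys ++ r) ≡ parseBottom acc (bs ++ ys) r
parseBottom-asBottom acc bs [] r = cong (λ bs′ → parseBottom acc bs′ r) (sym (++-identityʳ bs))
parseBottom-asBottom acc bs (y ∷ ys) r =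
  trans (parseBottom-asBottom acc (bs ∷ʳ y) ys r) (cong (λ bs′ → parseBottom acc bs′ r) (++-assoc bs [ y ] ys))

-- the last B′ may be empty: its cell may hold n alone
Shaped : List Column → Set
Shaped [] = ⊤
Shaped ((a , b) ∷ []) = NonEmpty a
Shaped ((a , b) ∷ c ∷ cs) = NonEmpty a × NonEmpty b × Shaped (c ∷ cs)

labelColumn-++ : ∀ a {m} b rest → lastOf a ≡ [ m ] →
  labelColumn (a , b) ++ rest ≡ asTop (dropLast a) ++ asBottom b ++ (m , true) ∷ rest
labelColumn-++ a {m} b rest lastOf≡m = begin
    (asTop (dropLast a) ++ asBottom b ++ asTop (lastOf a)) ++ rest
  ≡⟨ ++-assoc (asTop (dropLast a)) _ rest ⟩
    asTop (dropLast a) ++ (asBottom b ++ asTop (lastOf a)) ++ rest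
  ≡⟨ cong (asTop (dropLast a) ++_) (++-assoc (asBottom b) _ rest) ⟩
    asTop (dropLast a) ++ asBottom b ++ asTop (lastOf a) ++ rest
  ≡⟨ cong (λ l → asTop (dropLast a) ++ asBottom b ++ asTop l ++ rest) lastOf≡m ⟩
    asTop (dropLast a) ++ asBottom b ++ (m , true) ∷ rest
  ∎
  where open ≡-Reasoning

parse-labelColumn : ∀ a y ys rest → NonEmpty a →
  parse (labelColumn (a , y ∷ ys) ++ rest) ≡ (a , y ∷ ys) ∷ parse rest
parse-labelColumn a y ys rest ne with lastOf-nonEmpty a ne
... | m , lastOf≡m = begin
    parse (labelColumn (a , y ∷ ys) ++ rest)
  ≡⟨ cong parse (labelColumn-++ a (y ∷ ys) rest lastOf≡m) ⟩
    parseTop [] (asTop (dropLast a) ++ asBottom (y ∷ ys) ++ (m , true) ∷ rest)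
  ≡⟨ parseTop-asTop [] (dropLast a) _ ⟩
    parseBottom (dropLast a) [ y ] (asBottom ys ++ (m , true) ∷ rest)
  ≡⟨ parseBottom-asBottom (dropLast a) [ y ] ys _ ⟩
    (dropLast a ∷ʳ m , y ∷ ys) ∷ parse rest
  ≡⟨ cong (λ a′ → (a′ , y ∷ ys) ∷ parse rest) (dropLast∷ʳlast a lastOf≡m) ⟩
    (a , y ∷ ys) ∷ parse rest
  ∎
  where open ≡-Reasoning

parse-lastColumn : ∀ a → NonEmpty a → parse (labelColumn (a , []) ++ []) ≡ [ (a , []) ]
parse-lastColumn a ne with lastOf-nonEmpty a ne
... | m , lastOf≡m = begin
    parse (labelColumn (a , []) ++ [])
  ≡⟨ cong parse (labelColumn-++ a [] [] lastOf≡m) ⟩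
    parseTop [] (asTop (dropLast a) ++ [ (m , true) ])
  ≡⟨ parseTop-asTop [] (dropLast a) _ ⟩
    parseTop (dropLast a ∷ʳ m) []
  ≡⟨ cong (λ a′ → parseTop a′ []) (dropLast∷ʳlast a lastOf≡m) ⟩
    parseTop a []
  ≡⟨ finalColumn-nonEmpty a ne ⟩
    [ (a , []) ]
  ∎
  where
  open ≡-Reasoning
  finalColumn-nonEmpty : ∀ a → NonEmpty a → finalColumn a ≡ [ (a , []) ]
  finalColumn-nonEmpty (_ ∷ _) _ = refl

parse-labelColumns : ∀ cs → Shaped cs → parse (labelColumns cs) ≡ cs
parse-labelColumns [] _ = refl
parse-labelColumns ((a , []) ∷ []) ne = parse-lastColumn a ne
parse-labelColumns ((a , y ∷ ys) ∷ []) ne = parse-labelColumn a y ys [] ne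
parse-labelColumns ((a , []) ∷ c ∷ cs) (_ , () , _)
parse-labelColumns ((a , y ∷ ys) ∷ c ∷ cs) (ne , _ , shaped) =
  trans (parse-labelColumn a y ys (labelColumns (c ∷ cs)) ne)
        (cong ((a , y ∷ ys) ∷_) (parse-labelColumns (c ∷ cs) shaped))

EndsInTop : LWord → Set
EndsInTop [] = ⊥
EndsInTop ((x , t) ∷ []) = t ≡ true
EndsInTop (p ∷ q ∷ r) = EndsInTop (q ∷ r)

EmptyOrEndsInTop : LWord → Set
EmptyOrEndsInTop [] = ⊤
EmptyOrEndsInTop (p ∷ r) = EndsInTop (p ∷ r)

EndsInTop-afterTop : ∀ x r → EndsInTop ((x , true) ∷ r) → EmptyOrEndsInTop r
EndsInTop-afterTop x [] _ = tt
EndsInTop-afterTop x (q ∷ r) e = e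

EndsInTop-afterBottom : ∀ x r → EndsInTop ((x , false) ∷ r) → EndsInTop r
EndsInTop-afterBottom x (q ∷ r) e = e

labelColumns-parseTop : ∀ acc L → EmptyOrEndsInTop L → labelColumns (parseTop acc L) ≡ asTop acc ++ L
labelColumns-parseBottom : ∀ acc bs L → EndsInTop L →
  labelColumns (parseBottom acc bs L) ≡ asTop acc ++ asBottom bs ++ L
labelColumns-parseTop [] [] _ = refl
labelColumns-parseTop (a ∷ as) [] _ =
  cong (_++ []) (trans (sym (map-++ (_, true) (dropLast (a ∷ as)) (lastOf (a ∷ as))))
                       (cong asTop (dropLast++lastOf (a ∷ as))))
labelColumns-parseTop acc ((x , true) ∷ r) e =
  trans (labelColumns-parseTop (acc ∷ʳ x) r (EndsInTop-afterTop x r e))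
        (trans (cong (_++ r) (map-++ (_, true) acc [ x ])) (++-assoc (asTop acc) _ r))
labelColumns-parseTop acc ((x , false) ∷ r) e =
  labelColumns-parseBottom acc [ x ] r (EndsInTop-afterBottom x r e)
labelColumns-parseBottom acc bs ((x , false) ∷ r) e =
  trans (labelColumns-parseBottom acc (bs ∷ʳ x) r (EndsInTop-afterBottom x r e))
        (cong (asTop acc ++_) (trans (cong (_++ r) (map-++ (_, false) bs [ x ])) (++-assoc (asBottom bs) _ r)))
labelColumns-parseBottom acc bs ((x , true) ∷ r) e
  rewrite dropLast-∷ʳ acc x | lastOf-∷ʳ acc x | labelColumns-parseTop [] r (EndsInTop-afterTop x r e) =
  trans (++-assoc (asTop acc) _ r) (cong (asTop acc ++_) (++-assoc (asBottom bs) _ r))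

labelColumns-parse : ∀ L → EmptyOrEndsInTop L → labelColumns (parse L) ≡ L
labelColumns-parse = labelColumns-parseTop []

Shaped-parseTop : ∀ acc L → EmptyOrEndsInTop L → Shaped (parseTop acc L)
Shaped-parseBottom : ∀ acc bs L → NonEmpty bs → EndsInTop L → Shaped (parseBottom acc bs L)
Shaped-parseTop [] [] _ = tt
Shaped-parseTop (a ∷ as) [] _ = tt
Shaped-parseTop acc ((x , true) ∷ r) e = Shaped-parseTop (acc ∷ʳ x) r (EndsInTop-afterTop x r e)
Shaped-parseTop acc ((x , false) ∷ r) e = Shaped-parseBottom acc [ x ] r tt (EndsInTop-afterBottom x r e)
Shaped-parseBottom acc bs ((x , false) ∷ r) _ e =
  Shaped-parseBottom acc (bs ∷ʳ x) r (∷ʳ-nonEmpty bs x) (EndsInTop-afterBottom x r e)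
Shaped-parseBottom acc bs ((x , true) ∷ r) ne e
  with parseTop [] r | Shaped-parseTop [] r (EndsInTop-afterTop x r e)
... | [] | _ = ∷ʳ-nonEmpty acc x
... | c ∷ cs | shaped = ∷ʳ-nonEmpty acc x , ne , shaped

Shaped-parse : ∀ L → EmptyOrEndsInTop L → Shaped (parse L)
Shaped-parse = Shaped-parseTop []

Shaped-tops : ∀ cs → Shaped cs → All (NonEmpty ∘ proj₁) cs
Shaped-tops [] _ = []
Shaped-tops ((a , b) ∷ []) ne = ne ∷ []
Shaped-tops ((a , b) ∷ c ∷ cs) (ne , _ , shaped) = ne ∷ Shaped-tops (c ∷ cs) shaped

IncreasingColumn : Column → Set
IncreasingColumn (a , b) = Sorted a × Sorted b × a ≺ b

IncreasingColumns : Column → Column → Set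
IncreasingColumns (a , b) (a′ , b′) = a ≺ a′ × a ≺ b′ × b ≺ b′

Standard : List Column → Set
Standard cs = All IncreasingColumn cs × AllPairs IncreasingColumns cs

AllInColumn : (Letter → Set) → Column → Set
AllInColumn Q (a , b) = All (λ u → Q (u , true)) a × All (λ v → Q (v , false)) b

All-labelColumn⁺ : ∀ {Q} c → AllInColumn Q c → All Q (labelColumn c)
All-labelColumn⁺ (a , b) (ha , hb) =
  AllP.++⁺ (AllP.map⁺ (All-dropLast a ha)) (AllP.++⁺ (AllP.map⁺ hb) (AllP.map⁺ (All-lastOf a ha)))

All-labelColumns⁺ : ∀ {Q} cs → All (AllInColumn Q) cs → All Q (labelColumns cs)
All-labelColumns⁺ [] [] = []
All-labelColumns⁺ (c ∷ cs) (h ∷ hs) = AllP.++⁺ (All-labelColumn⁺ c h) (All-labelColumns⁺ cs hs)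

All-labelColumn⁻ : ∀ {Q} c → All Q (labelColumn c) → AllInColumn Q c
All-labelColumn⁻ (a , b) h =
  let (hdrop , hrest) = AllP.++⁻ (asTop (dropLast a)) h
      (hb , hlast) = AllP.++⁻ (asBottom b) hrest
  in All-dropLast-lastOf a (AllP.map⁻ hdrop) (AllP.map⁻ hlast) , AllP.map⁻ hb

All-labelColumns⁻ : ∀ {Q} cs → All Q (labelColumns cs) → All (AllInColumn Q) cs
All-labelColumns⁻ [] _ = []
All-labelColumns⁻ (c ∷ cs) h =
  let (hc , hcs) = AllP.++⁻ (labelColumn c) h in All-labelColumn⁻ c hc ∷ All-labelColumns⁻ cs hcs

BottomsNotLeast-++ : ∀ L L′ → BottomsNotLeast L → BottomsNotLeast L′ → BottomsNotLeast (L ++ L′)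
BottomsNotLeast-++ [] L′ _ h = h
BottomsNotLeast-++ ((x , true) ∷ L) L′ h h′ = BottomsNotLeast-++ L L′ h h′
BottomsNotLeast-++ ((x , false) ∷ L) L′ (below , h) h′ = AnyP.++⁺ˡ below , BottomsNotLeast-++ L L′ h h′

BottomsNotLeast-++⁻ʳ : ∀ L L′ → BottomsNotLeast (L ++ L′) → BottomsNotLeast L′
BottomsNotLeast-++⁻ʳ [] L′ h = h
BottomsNotLeast-++⁻ʳ (p ∷ L) L′ h = BottomsNotLeast-++⁻ʳ L L′ (BottomsNotLeast-tail p (L ++ L′) h)

BottomsNotLeast-asTop : ∀ xs L → BottomsNotLeast L → BottomsNotLeast (asTop xs ++ L)
BottomsNotLeast-asTop [] L h = h
BottomsNotLeast-asTop (x ∷ xs) L h = BottomsNotLeast-asTop xs L h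

BottomsNotLeast-asBottom : ∀ m b → All (m <_) b → BottomsNotLeast (asBottom b ++ [ (m , true) ])
BottomsNotLeast-asBottom m [] [] = tt
BottomsNotLeast-asBottom m (v ∷ b) (m<v ∷ m<b) =
  AnyP.++⁺ʳ (asBottom b) (here m<v) , BottomsNotLeast-asBottom m b m<b

CanPrecede-bottom-asTop : ∀ v xs → All (CanPrecede (v , false)) (asTop xs)
CanPrecede-bottom-asTop v [] = []
CanPrecede-bottom-asTop v (x ∷ xs) = tt ∷ CanPrecede-bottom-asTop v xs

CanPrecede-labelColumn : ∀ c → IncreasingColumn c → AllPairs CanPrecede (labelColumn c)
CanPrecede-labelColumn (a , b) (sorted-a , sorted-b , a≺b) =
  let (sorted-drop , sorted-last , drop≺last) = Sorted-++⁻ (dropLast a) (subst Sorted (sym (dropLast++lastOf a)) sorted-a) in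
  AllPairsP.++⁺ (AllPairsP.map⁺ sorted-drop)
    (AllPairsP.++⁺ (AllPairsP.map⁺ sorted-b) (AllPairsP.map⁺ sorted-last)
      (AllP.map⁺ (All.universal (λ v → CanPrecede-bottom-asTop v (lastOf a)) b)))
    (AllP.map⁺ (All.zipWith (λ (h , h′) → AllP.++⁺ (AllP.map⁺ h) (AllP.map⁺ h′))
                            (All-dropLast a a≺b , drop≺last)))

BottomsNotLeast-labelColumn : ∀ c → IncreasingColumn c → NonEmpty (proj₁ c) → BottomsNotLeast (labelColumn c)
BottomsNotLeast-labelColumn (a , b) (_ , _ , a≺b) ne with lastOf-nonEmpty a ne
... | m , lastOf≡m =
  BottomsNotLeast-asTop (dropLast a) _ (subst (λ l → BottomsNotLeast (asBottom b ++ asTop l)) (sym lastOf≡m)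
    (BottomsNotLeast-asBottom m b (All.head (subst (_≺ b) lastOf≡m (All-lastOf a a≺b)))))

wellLabelled-labelColumns : ∀ cs → Standard cs → All (NonEmpty ∘ proj₁) cs → WellLabelled (labelColumns cs)
wellLabelled-labelColumns [] _ _ = [] , tt
wellLabelled-labelColumns ((a , b) ∷ cs) (inc ∷ incs , rel ∷ rels) (ne ∷ nes) =
  AllPairsP.++⁺ (CanPrecede-labelColumn (a , b) inc) (proj₁ later) (All-labelColumn⁺ (a , b) (tops-before , bottoms-before)) ,
  BottomsNotLeast-++ (labelColumn (a , b)) (labelColumns cs) (BottomsNotLeast-labelColumn (a , b) inc ne) (proj₂ later)
  where
  later : WellLabelled (labelColumns cs)
  later = wellLabelled-labelColumns cs (incs , rels) nes
  tops-before : All (λ u → All (CanPrecede (u , true)) (labelColumns cs)) a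
  tops-before = All.map (All-labelColumns⁺ cs)
    (AllP.All-swap (All.map (λ (a≺a′ , a≺b′ , _) → All.zip (a≺a′ , a≺b′)) rel))
  bottoms-before : All (λ v → All (CanPrecede (v , false)) (labelColumns cs)) b
  bottoms-before = All.map (All-labelColumns⁺ cs)
    (AllP.All-swap (All.map (λ {(a′ , _)} (_ , _ , b≺b′) →
      All.map (λ v<b′ → All.universal (λ _ → tt) a′ , v<b′) b≺b′) rel))

-- The smaller letter required after a bottom letter v cannot be a later bottom letter of its
-- column (those exceed v), so it is the column's last top letter m or comes after it.
lastTop-below-bottom : ∀ v m b′ rest → Any (Below v) (asBottom b′ ++ (m , true) ∷ rest) →
  All (CanPrecede (v , false)) (asBottom b′) → All (CanPrecede (m , true)) rest → m < v
lastTop-below-bottom v m [] rest (here m<v) _ _ = m<v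
lastTop-below-bottom v m [] rest (there below) _ m<rest =
  let (m<u , u<v) = All.lookupAny m<rest below in <-trans m<u u<v
lastTop-below-bottom v m (y ∷ b′) rest (here y<v) (v<y ∷ _) _ = ⊥-elim (<-asym y<v v<y)
lastTop-below-bottom v m (y ∷ b′) rest (there below) (_ ∷ v<b′) m<rest =
  lastTop-below-bottom v m b′ rest below v<b′ m<rest

lastTop-below-bottoms : ∀ m b rest → WellLabelled (asBottom b ++ (m , true) ∷ rest) → All (m <_) b
lastTop-below-bottoms m [] rest _ = []
lastTop-below-bottoms m (v ∷ b) rest (v-before ∷ ap , below , bn) =
  lastTop-below-bottom v m b rest below (AllP.++⁻ˡ (asBottom b) v-before)
    (AllPairs.head (proj₁ (proj₂ (AllPairs-++⁻ (asBottom b) ap))))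
  ∷ lastTop-below-bottoms m b rest (ap , bn)

sorted-labelColumn : ∀ a b → AllPairs CanPrecede (labelColumn (a , b)) → Sorted a × Sorted b × dropLast a ≺ b
sorted-labelColumn a b ap =
  let (ap-drop , ap-rest , drop-before) = AllPairs-++⁻ (asTop (dropLast a)) ap
      (ap-b , ap-last , _) = AllPairs-++⁻ (asBottom b) ap-rest
      drop-before′ = AllP.map⁻ drop-before
  in subst Sorted (dropLast++lastOf a)
       (AllPairsP.++⁺ (AllPairsP.map⁻ ap-drop) (AllPairsP.map⁻ ap-last)
                      (All.map (λ h → AllP.map⁻ (AllP.++⁻ʳ (asBottom b) h)) drop-before′)) ,
     AllPairsP.map⁻ ap-b ,
     All.map (λ h → AllP.map⁻ (AllP.++⁻ˡ (asBottom b) h)) drop-before′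

increasingColumn : ∀ c rest → NonEmpty (proj₁ c) → WellLabelled (labelColumn c ++ rest) → IncreasingColumn c
increasingColumn (a , b) rest ne (ap , bn) with lastOf-nonEmpty a ne
... | m , lastOf≡m =
  let (sorted-a , sorted-b , drop≺b) = sorted-labelColumn a b (proj₁ (AllPairs-++⁻ (labelColumn (a , b)) ap))
  in sorted-a , sorted-b ,
     All-dropLast-lastOf a drop≺b (subst (_≺ b) (sym lastOf≡m) (lastTop-below-bottoms m b rest after-drop ∷ []))
  where
  split : labelColumn (a , b) ++ rest ≡ asTop (dropLast a) ++ asBottom b ++ (m , true) ∷ rest
  split = labelColumn-++ a b rest lastOf≡m
  after-drop : WellLabelled (asBottom b ++ (m , true) ∷ rest)
  after-drop = proj₁ (proj₂ (AllPairs-++⁻ (asTop (dropLast a)) (subst (AllPairs CanPrecede) split ap))) ,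
               BottomsNotLeast-++⁻ʳ (asTop (dropLast a)) _ (subst BottomsNotLeast split bn)

increasingColumns : ∀ c cs → All (λ p → All (CanPrecede p) (labelColumns cs)) (labelColumn c) →
  All (IncreasingColumns c) cs
increasingColumns (a , b) cs h =
  let (ha , hb) = All-labelColumn⁻ (a , b) h
  in combine (AllP.All-swap (All.map (All-labelColumns⁻ cs) ha)) (AllP.All-swap (All.map (All-labelColumns⁻ cs) hb))
  where
  combine : ∀ {cs′} → All (λ c′ → All (λ u → AllInColumn (CanPrecede (u , true)) c′) a) cs′ →
                      All (λ c′ → All (λ v → AllInColumn (CanPrecede (v , false)) c′) b) cs′ →
                      All (IncreasingColumns (a , b)) cs′
  combine [] [] = []
  combine (ha ∷ has) (hb ∷ hbs) = (All.map proj₁ ha , All.map proj₂ ha , All.map proj₂ hb) ∷ combine has hbs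

standard-labelColumns : ∀ cs → WellLabelled (labelColumns cs) → All (NonEmpty ∘ proj₁) cs → Standard cs
standard-labelColumns [] _ _ = [] , []
standard-labelColumns (c ∷ cs) (ap , bn) (ne ∷ nes) =
  let (_ , ap-rest , across) = AllPairs-++⁻ (labelColumn c) ap
      (incs , rels) = standard-labelColumns cs (ap-rest , BottomsNotLeast-++⁻ʳ (labelColumn c) (labelColumns cs) bn) nes
  in increasingColumn c (labelColumns cs) ne (ap , bn) ∷ incs , increasingColumns c cs across ∷ rels

tagValleys-asTop : ∀ xs L → tagValleys true (asTop xs ++ L) ≡ tagValleys true L
tagValleys-asTop [] L = refl
tagValleys-asTop (x ∷ xs) L = tagValleys-asTop xs L

tagValleys-asBottom : ∀ ys L → tagValleys false (asBottom ys ++ L) ≡ tagValleys false L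
tagValleys-asBottom [] L = refl
tagValleys-asBottom (y ∷ ys) L = tagValleys-asBottom ys L

tagValleys-labelColumn : ∀ a b rest → NonEmpty a → NonEmpty b →
  tagValleys true (labelColumn (a , b) ++ rest) ≡ (if not (null rest) then 1 else 0) + tagValleys true rest
tagValleys-labelColumn a (y ∷ ys) rest ne _ with lastOf-nonEmpty a ne
... | m , lastOf≡m = begin
    tagValleys true (labelColumn (a , y ∷ ys) ++ rest)
  ≡⟨ cong (tagValleys true) (labelColumn-++ a (y ∷ ys) rest lastOf≡m) ⟩
    tagValleys true (asTop (dropLast a) ++ (y , false) ∷ asBottom ys ++ (m , true) ∷ rest)
  ≡⟨ tagValleys-asTop (dropLast a) _ ⟩
    tagValleys false (asBottom ys ++ (m , true) ∷ rest)
  ≡⟨ tagValleys-asBottom ys _ ⟩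
    (if not (null rest) then 1 else 0) + tagValleys true rest
  ∎
  where open ≡-Reasoning

tagValleys-lastColumn : ∀ a → NonEmpty a → tagValleys true (labelColumn (a , []) ++ []) ≡ 0
tagValleys-lastColumn a ne with lastOf-nonEmpty a ne
... | m , lastOf≡m =
  trans (cong (tagValleys true) (labelColumn-++ a [] [] lastOf≡m)) (tagValleys-asTop (dropLast a) [ (m , true) ])

null-labelColumn : ∀ c rest → NonEmpty (proj₁ c) → null (labelColumn c ++ rest) ≡ false
null-labelColumn (a , b) rest ne with lastOf-nonEmpty a ne
... | m , lastOf≡m rewrite labelColumn-++ a b rest lastOf≡m = nonNull (asTop (dropLast a)) (asBottom b)
  where
  nonNull : ∀ L L′ → null (L ++ L′ ++ (m , true) ∷ rest) ≡ false
  nonNull (_ ∷ _) _ = refl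
  nonNull [] (_ ∷ _) = refl
  nonNull [] [] = refl

tagValleys-labelColumns : ∀ cs → Shaped cs → tagValleys true (labelColumns cs) ≡ length cs ∸ 1
tagValleys-labelColumns [] _ = refl
tagValleys-labelColumns ((a , []) ∷ []) ne = tagValleys-lastColumn a ne
tagValleys-labelColumns ((a , y ∷ ys) ∷ []) ne = tagValleys-labelColumn a (y ∷ ys) [] ne tt
tagValleys-labelColumns ((a , []) ∷ c ∷ cs) (_ , () , _)
tagValleys-labelColumns ((a , y ∷ ys) ∷ c ∷ cs) (ne , _ , shaped) =
  trans (tagValleys-labelColumn a (y ∷ ys) (labelColumns (c ∷ cs)) ne tt)
        (cong₂ _+_ (cong (λ e → if not e then 1 else 0)
                         (null-labelColumn c (labelColumns cs) (All.head (Shaped-tops (c ∷ cs) shaped))))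
                   (tagValleys-labelColumns (c ∷ cs) shaped))

-- Subsets of [n] as sorted lists

Unique-resp-↭ : ∀ {xs ys : List ℕ} → xs ↭ ys → Unique xs → Unique ys
Unique-resp-↭ p = PermutationₛP.Unique-resp-↭ (setoid ℕ) (↭⇒↭ₛ p)

Sorted⇒Unique : ∀ {xs} → Sorted xs → Unique xs
Sorted⇒Unique = AllPairs.map <⇒≢

unique-↭ : ∀ {xs ys : List ℕ} → Unique xs → Unique ys →
  (∀ {v} → v ∈ xs → v ∈ ys) → (∀ {v} → v ∈ ys → v ∈ xs) → xs ↭ ys
unique-↭ u u′ xs⊆ys ys⊆xs = ∼bag⇒↭ (unique∧set⇒bag u u′ (mk⇔ xs⊆ys ys⊆xs))

Sorted-≡ : ∀ xs ys → Sorted xs → Sorted ys →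
  (∀ {v} → v ∈ xs → v ∈ ys) → (∀ {v} → v ∈ ys → v ∈ xs) → xs ≡ ys
Sorted-≡ [] [] _ _ _ _ = refl
Sorted-≡ [] (y ∷ ys) _ _ _ ys⊆xs with ys⊆xs (here refl)
... | ()
Sorted-≡ (x ∷ xs) [] _ _ xs⊆ys _ with xs⊆ys (here refl)
... | ()
Sorted-≡ (x ∷ xs) (y ∷ ys) (x<xs ∷ sorted-xs) (y<ys ∷ sorted-ys) xs⊆ys ys⊆xs =
  cong₂ _∷_ x≡y (Sorted-≡ xs ys sorted-xs sorted-ys tail⊆ tail⊇)
  where
  head≤ : ∀ {x xs v} → All (x <_) xs → v ∈ x ∷ xs → x ≤ v
  head≤ _ (here refl) = ≤-refl
  head≤ x<xs (there v∈xs) = <⇒≤ (All.lookup x<xs v∈xs)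
  x≡y : x ≡ y
  x≡y = ≤-antisym (head≤ x<xs (ys⊆xs (here refl))) (head≤ y<ys (xs⊆ys (here refl)))
  tail⊆ : ∀ {v} → v ∈ xs → v ∈ ys
  tail⊆ v∈xs with xs⊆ys (there v∈xs)
  ... | here refl = ⊥-elim (<-irrefl x≡y (All.lookup x<xs v∈xs))
  ... | there v∈ys = v∈ys
  tail⊇ : ∀ {v} → v ∈ ys → v ∈ xs
  tail⊇ v∈ys with ys⊆xs (there v∈ys)
  ... | here refl = ⊥-elim (<-irrefl (sym x≡y) (All.lookup y<ys v∈ys))
  ... | there v∈xs = v∈xs

∈-concat-tabulate⁻ : ∀ {A : Set} {k} (f : Fin k → List A) {v} → v ∈ concat (tabulate f) → ∃ λ i → v ∈ f i
∈-concat-tabulate⁻ f v∈ with ∈P.∈-concat⁻′ (tabulate f) v∈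
... | xs , v∈xs , xs∈ with ∈P.∈-tabulate⁻ xs∈
... | i , refl = i , v∈xs

∈-concat-tabulate⁺ : ∀ {A : Set} {k} (f : Fin k → List A) {v} i → v ∈ f i → v ∈ concat (tabulate f)
∈-concat-tabulate⁺ f i v∈ = ∈P.∈-concat⁺′ v∈ (∈P.∈-tabulate⁺ i)

module _ {n : ℕ} where

  entry : Fin n → ℕ
  entry z = suc (toℕ z)

  entry-injective : ∀ {z z′ : Fin n} → entry z ≡ entry z′ → z ≡ z′
  entry-injective e = FinP.toℕ-injective (suc-injective e)

  IsEntry : ℕ → Set
  IsEntry v = ∃ λ (z : Fin n) → v ≡ entry z

  Sorted-elems : ∀ (p : Subset n) → Sorted (elems p)
  Sorted-elems p = AllPairsP.map⁺ (AllPairsP.filter⁺ (SubsetP._∈? p) {xs = allFin n}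
                     (AllPairsP.tabulate⁺-< {R = λ z z′ → entry z < entry z′} s≤s))

  ∈-elems⁻ : ∀ (p : Subset n) {v} → v ∈ elems p → ∃ λ z → z ∈ₛ p × v ≡ entry z
  ∈-elems⁻ p v∈ with ∈P.∈-map⁻ entry v∈
  ... | z , z∈ , v≡ = z , proj₂ (∈P.∈-filter⁻ (SubsetP._∈? p) {xs = allFin n} z∈) , v≡

  ∈-elems⁺ : ∀ {p : Subset n} {z} → z ∈ₛ p → entry z ∈ elems p
  ∈-elems⁺ {p} {z} z∈p = ∈P.∈-map⁺ entry (∈P.∈-filter⁺ (SubsetP._∈? p) (∈P.∈-allFin z) z∈p)

  ∈-elems⇒∈ₛ : ∀ {p : Subset n} {z} → entry z ∈ elems p → z ∈ₛ p
  ∈-elems⇒∈ₛ {p} v∈ with ∈-elems⁻ p v∈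
  ... | z′ , z′∈p , e = subst (_∈ₛ p) (sym (entry-injective e)) z′∈p

  elems-injective : ∀ {p q : Subset n} → elems p ≡ elems q → p ≡ q
  elems-injective {p} {q} e = SubsetP.⊆-antisym
    (λ z∈p → ∈-elems⇒∈ₛ {q} (subst (_ ∈_) e (∈-elems⁺ z∈p)))
    (λ z∈q → ∈-elems⇒∈ₛ {p} (subst (_ ∈_) (sym e) (∈-elems⁺ z∈q)))

  fromList : List ℕ → Subset n
  fromList vs = Vec.tabulate (λ z → does (entry z ∈? vs))

  ∈-fromList⁻ : ∀ {vs z} → z ∈ₛ fromList vs → entry z ∈ vs
  ∈-fromList⁻ {vs} {z} z∈ with entry z ∈? vs
    | trans (sym (VecP.lookup∘tabulate (λ z → does (entry z ∈? vs)) z)) (VecP.[]=⇒lookup z∈)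
  ... | yes v∈ | _ = v∈
  ... | no _ | ()

  ∈-fromList⁺ : ∀ {vs z} → entry z ∈ vs → z ∈ₛ fromList vs
  ∈-fromList⁺ {vs} {z} v∈ with entry z ∈? vs | VecP.lookup∘tabulate (λ z → does (entry z ∈? vs)) z
  ... | yes _ | lookup≡ = VecP.lookup⇒[]= z (fromList vs) lookup≡
  ... | no v∉ | _ = ⊥-elim (v∉ v∈)

  elems-fromList : ∀ vs → Sorted vs → All IsEntry vs → elems (fromList vs) ≡ vs
  elems-fromList vs sorted entries = Sorted-≡ _ vs (Sorted-elems _) sorted ⊆vs vs⊆
    where
    ⊆vs : ∀ {v} → v ∈ elems (fromList vs) → v ∈ vs
    ⊆vs v∈ with ∈-elems⁻ _ v∈
    ... | z , z∈ , refl = ∈-fromList⁻ z∈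
    vs⊆ : ∀ {v} → v ∈ vs → v ∈ elems (fromList vs)
    vs⊆ v∈ with All.lookup entries v∈
    ... | z , refl = ∈-elems⁺ (∈-fromList⁺ v∈)

  nonempty-fromList : ∀ vs → NonEmpty vs → All IsEntry vs → Nonempty (fromList vs)
  nonempty-fromList (v ∷ vs) _ ((z , v≡) ∷ _) = z , ∈-fromList⁺ {v ∷ vs} (here (sym v≡))

  ∈-⋃-toList⁻ : ∀ {k} (ps : Vec (Subset n) k) {z} → z ∈ₛ ⋃ (Vec.toList ps) → ∃ λ c → z ∈ₛ Vec.lookup ps c
  ∈-⋃-toList⁻ Vec.[] z∈ = ⊥-elim (SubsetP.∉⊥ z∈)
  ∈-⋃-toList⁻ (p Vec.∷ ps) z∈ with SubsetP.x∈p∪q⁻ p (⋃ (Vec.toList ps)) z∈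
  ... | inj₁ z∈p = F.zero , z∈p
  ... | inj₂ z∈⋃ = let (c , z∈c) = ∈-⋃-toList⁻ ps z∈⋃ in F.suc c , z∈c

  ∈-⋃-toList⁺ : ∀ {k} (ps : Vec (Subset n) k) {z} c → z ∈ₛ Vec.lookup ps c → z ∈ₛ ⋃ (Vec.toList ps)
  ∈-⋃-toList⁺ (p Vec.∷ ps) F.zero z∈ = SubsetP.x∈p∪q⁺ (inj₁ z∈)
  ∈-⋃-toList⁺ (p Vec.∷ ps) (F.suc c) z∈ = SubsetP.x∈p∪q⁺ (inj₂ (∈-⋃-toList⁺ ps c z∈))

-- From tableaux to words

∈⇒NonEmpty : ∀ {v vs} → v ∈ vs → NonEmpty vs
∈⇒NonEmpty {vs = _ ∷ _} _ = tt

columnWord-↭ : ∀ a b → columnWord (a , b) ↭ a ++ b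
columnWord-↭ a b = ↭-trans (↭P.++⁺ˡ (dropLast a) (↭P.++-comm b (lastOf a)))
  (↭-reflexive (trans (sym (++-assoc (dropLast a) (lastOf a) b)) (cong (_++ b) (dropLast++lastOf a))))

∈-columnWord⁻ : ∀ a b {v} → v ∈ columnWord (a , b) → v ∈ a ⊎ v ∈ b
∈-columnWord⁻ a b v∈ = ∈P.∈-++⁻ a (↭P.∈-resp-↭ (columnWord-↭ a b) v∈)

∈-columnWord⁺ : ∀ a b {v} → v ∈ a ⊎ v ∈ b → v ∈ columnWord (a , b)
∈-columnWord⁺ a b (inj₁ v∈a) = ↭P.∈-resp-↭ (↭-sym (columnWord-↭ a b)) (∈P.∈-++⁺ˡ v∈a)
∈-columnWord⁺ a b (inj₂ v∈b) = ↭P.∈-resp-↭ (↭-sym (columnWord-↭ a b)) (∈P.∈-++⁺ʳ a v∈b)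

Unique-columnWord : ∀ c → IncreasingColumn c → Unique (columnWord c)
Unique-columnWord (a , b) (sorted-a , sorted-b , a≺b) =
  Unique-resp-↭ (↭-sym (columnWord-↭ a b)) (Sorted⇒Unique (AllPairsP.++⁺ sorted-a sorted-b a≺b))

Shaped-tabulate : ∀ {k} (f : Fin k → Column) → (∀ c → NonEmpty (proj₁ (f c))) →
  (∀ c → suc (toℕ c) ≢ k → NonEmpty (proj₂ (f c))) → Shaped (tabulate f)
Shaped-tabulate {0} f _ _ = tt
Shaped-tabulate {1} f tops _ = tops F.zero
Shaped-tabulate {suc (suc k)} f tops bottoms =
  tops F.zero , bottoms F.zero (λ ()) ,
  Shaped-tabulate (f ∘ F.suc) (tops ∘ F.suc) (λ c c≢ → bottoms (F.suc c) (c≢ ∘ suc-injective))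

module FromTableau {m : ℕ} (T : Tab (suc m)) (S : IsSYT T) where
  open IsSYT S

  largest : Fin (suc m)
  largest = F.fromℕ m

  entry-largest : entry largest ≡ suc m
  entry-largest = cong suc (FinP.toℕ-fromℕ m)

  entry≡n⇒largest : ∀ {z} → entry z ≡ suc m → z ≡ largest
  entry≡n⇒largest e = entry-injective (trans e (sym entry-largest))

  A B : Fin (b T) → Subset (suc m)
  A c = Vec.lookup (top T) c
  B c = Vec.lookup (bot T) c

  top≤bottom : ∀ c {x y} → x ∈ₛ A c → y ∈ₛ B c → x F.< y
  top≤bottom c x∈ y∈ = increasing F.zero c (F.suc F.zero) c z≤n ≤-refl (λ { (() , _) }) _ _ x∈ y∈

  largest-maximal : ∀ (x : Fin (suc m)) → ¬ (largest F.< x)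
  largest-maximal x lt = <-irrefl refl (<-≤-trans (subst (_< toℕ x) (FinP.toℕ-fromℕ m) lt) (FinP.toℕ≤pred[n] x))

  largest∉A : ∀ c → ¬ (largest ∈ₛ A c)
  largest∉A c n∈ with nonempty (F.suc F.zero) c
  ... | y , y∈ = largest-maximal y (top≤bottom c n∈ y∈)

  largest∈B⇒last : ∀ c → largest ∈ₛ B c → suc (toℕ c) ≡ b T
  largest∈B⇒last c n∈ with suc (toℕ c) ≟ b T
  ... | yes last = last
  ... | no ¬last = ⊥-elim (no-next-bottom (≤∧≢⇒< (FinP.toℕ<n c) ¬last))
    where
    no-next-bottom : suc (toℕ c) < b T → ⊥
    no-next-bottom c+1<b with nonempty (F.suc F.zero) (F.fromℕ< c+1<b)
    ... | y , y∈ = largest-maximal y (increasing (F.suc F.zero) c (F.suc F.zero) (F.fromℕ< c+1<b) ≤-refl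
                     (<⇒≤ c<next) (λ (_ , c≡) → <-irrefl (cong toℕ c≡) c<next) largest y n∈ y∈)
      where
      c<next : toℕ c < toℕ (F.fromℕ< c+1<b)
      c<next = subst (toℕ c <_) (sym (FinP.toℕ-fromℕ< c+1<b)) ≤-refl

  largest∈lastB : ∀ c → suc (toℕ c) ≡ b T → largest ∈ₛ B c
  largest∈lastB c last with covers largest
  ... | F.zero , c′ , n∈ = ⊥-elim (largest∉A c′ n∈)
  ... | F.suc F.zero , c′ , n∈ =
    subst (λ d → largest ∈ₛ B d) (FinP.toℕ-injective (suc-injective (trans (largest∈B⇒last c′ n∈) (sym last)))) n∈

  ≢n? : ∀ v → Dec (¬ (v ≡ suc m))
  ≢n? v = ¬? (v ≟ suc m)

  B′≡filter : ∀ c → B′ T c ≡ filter ≢n? (elems (B c))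
  B′≡filter c with suc (toℕ c) ≟ b T
  ... | yes _ = refl
  ... | no ¬last = sym (filter-all ≢n? (All.tabulate λ v∈ v≡n → ¬last (largest∈B⇒last c (n∈ v∈ v≡n))))
    where
    n∈ : ∀ {v} → v ∈ elems (B c) → v ≡ suc m → largest ∈ₛ B c
    n∈ v∈ v≡n with ∈-elems⁻ (B c) v∈
    ... | z , z∈ , refl = subst (_∈ₛ B c) (entry≡n⇒largest v≡n) z∈

  ∈B′⇒∈B : ∀ c {v} → v ∈ B′ T c → v ∈ elems (B c)
  ∈B′⇒∈B c v∈ = proj₁ (∈P.∈-filter⁻ ≢n? {xs = elems (B c)} (subst (_ ∈_) (B′≡filter c) v∈))

  ∈B′⇒≢n : ∀ c {v} → v ∈ B′ T c → ¬ (v ≡ suc m)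
  ∈B′⇒≢n c v∈ = proj₂ (∈P.∈-filter⁻ ≢n? {xs = elems (B c)} (subst (_ ∈_) (B′≡filter c) v∈))

  ∈B⇒∈B′⊎n : ∀ c {v} → v ∈ elems (B c) → v ∈ B′ T c ⊎ (v ≡ suc m × suc (toℕ c) ≡ b T)
  ∈B⇒∈B′⊎n c {v} v∈ with v ≟ suc m
  ... | yes v≡n with ∈-elems⁻ (B c) v∈
  ...   | z , z∈ , refl = inj₂ (v≡n , largest∈B⇒last c (subst (_∈ₛ B c) (entry≡n⇒largest v≡n) z∈))
  ∈B⇒∈B′⊎n c v∈ | no v≢n = inj₁ (subst (_ ∈_) (sym (B′≡filter c)) (∈P.∈-filter⁺ ≢n? v∈ v≢n))

  ∈B′⊎n⇒∈B : ∀ c {v} → v ∈ B′ T c ⊎ (v ≡ suc m × suc (toℕ c) ≡ b T) → v ∈ elems (B c)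
  ∈B′⊎n⇒∈B c (inj₁ v∈) = ∈B′⇒∈B c v∈
  ∈B′⊎n⇒∈B c (inj₂ (refl , last)) = subst (_∈ elems (B c)) entry-largest (∈-elems⁺ (largest∈lastB c last))

  column : Fin (b T) → Column
  column c = elems (A c) , B′ T c

  columns : List Column
  columns = tabulate column

  α≡concat : α T ≡ concat (tabulate (columnWord ∘ column))
  α≡concat = cong concat (map-tabulate (λ c → c) (columnWord ∘ column))

  α≡letters : α T ≡ letters (labelColumns columns)
  α≡letters = begin
      α T
    ≡⟨ α≡concat ⟩
      concat (tabulate (columnWord ∘ column))
    ≡⟨ cong concat (sym (map-tabulate column columnWord)) ⟩
      concat (map columnWord columns)
    ≡⟨ sym (letters-labelColumns columns) ⟩
      letters (labelColumns columns)
    ∎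
    where open ≡-Reasoning

  entries-increasing : ∀ r c r′ c′ → r F.≤ r′ → c F.≤ c′ → ¬ ((r ≡ r′) × (c ≡ c′)) →
    ∀ {u v} → u ∈ elems (cell T r c) → v ∈ elems (cell T r′ c′) → u < v
  entries-increasing r c r′ c′ r≤ c≤ distinct u∈ v∈
    with ∈-elems⁻ (cell T r c) u∈ | ∈-elems⁻ (cell T r′ c′) v∈
  ... | z , z∈ , refl | z′ , z′∈ , refl = s≤s (increasing r c r′ c′ r≤ c≤ distinct z z′ z∈ z′∈)

  column-increasing : ∀ c → IncreasingColumn (column c)
  column-increasing c =
    Sorted-elems (A c) ,
    subst Sorted (sym (B′≡filter c)) (AllPairsP.filter⁺ ≢n? (Sorted-elems (B c))) ,
    All.tabulate (λ u∈ → All.tabulate (λ v∈ →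
      entries-increasing F.zero c (F.suc F.zero) c z≤n ≤-refl (λ { (() , _) }) u∈ (∈B′⇒∈B c v∈)))

  columns-increasing : ∀ {i j} → i F.< j → IncreasingColumns (column i) (column j)
  columns-increasing {i} {j} i<j =
    All.tabulate (λ u∈ → All.tabulate (λ v∈ → entries-increasing F.zero i F.zero j z≤n (<⇒≤ i<j) i≢j u∈ v∈)) ,
    All.tabulate (λ u∈ → All.tabulate (λ v∈ →
      entries-increasing F.zero i (F.suc F.zero) j z≤n (<⇒≤ i<j) (λ { (() , _) }) u∈ (∈B′⇒∈B j v∈))) ,
    All.tabulate (λ u∈ → All.tabulate (λ v∈ →
      entries-increasing (F.suc F.zero) i (F.suc F.zero) j ≤-refl (<⇒≤ i<j) i≢j (∈B′⇒∈B i u∈) (∈B′⇒∈B j v∈)))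
    where
    i≢j : ∀ {r} → ¬ ((r ≡ r) × (i ≡ j))
    i≢j (_ , i≡j) = <-irrefl (cong toℕ i≡j) i<j

  standard : Standard columns
  standard = AllP.tabulate⁺ column-increasing , AllPairsP.tabulate⁺-< columns-increasing

  top-nonEmpty : ∀ c → NonEmpty (elems (A c))
  top-nonEmpty c with nonempty F.zero c
  ... | z , z∈ = ∈⇒NonEmpty (∈-elems⁺ {p = A c} z∈)

  bottom-nonEmpty : ∀ c → suc (toℕ c) ≢ b T → NonEmpty (B′ T c)
  bottom-nonEmpty c ¬last with nonempty (F.suc F.zero) c
  ... | z , z∈ with ∈B⇒∈B′⊎n c (∈-elems⁺ {p = B c} z∈)
  ...   | inj₁ v∈ = ∈⇒NonEmpty v∈
  ...   | inj₂ (_ , last) = ⊥-elim (¬last last)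

  shaped : Shaped columns
  shaped = Shaped-tabulate column top-nonEmpty bottom-nonEmpty

  wellLabelled : WellLabelled (labelColumns columns)
  wellLabelled = wellLabelled-labelColumns columns standard (AllP.tabulate⁺ top-nonEmpty)

  α-avoids321 : Avoids321 (α T)
  α-avoids321 = subst Avoids321 (sym α≡letters) (avoids321-letters _ (proj₁ wellLabelled))

  α-innerValleys : innerValleys (α T) ≡ b T ∸ 1
  α-innerValleys = begin
      innerValleys (α T)
    ≡⟨ cong innerValleys α≡letters ⟩
      innerValleys (letters (labelColumns columns))
    ≡⟨ innerValleys-letters _ wellLabelled ⟩
      tagValleys true (labelColumns columns)
    ≡⟨ tagValleys-labelColumns columns shaped ⟩
      length columns ∸ 1
    ≡⟨ cong (_∸ 1) (length-tabulate column) ⟩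
      b T ∸ 1
    ∎
    where open ≡-Reasoning

  α-rlMins : rlMins (α T) ≡ topEntries T
  α-rlMins = begin
      rlMins (α T)
    ≡⟨ cong rlMins α≡letters ⟩
      rlMins (letters (labelColumns columns))
    ≡⟨ rlMins-letters _ wellLabelled ⟩
      topLetters (labelColumns columns)
    ≡⟨ topLetters-labelColumns columns ⟩
      concat (map proj₁ columns)
    ≡⟨ cong concat (map-tabulate column proj₁) ⟩
      concat (tabulate (elems ∘ A))
    ≡⟨ Sorted-≡ _ _ sorted (Sorted-elems (⋃ (Vec.toList (top T)))) ⊆top ⊇top ⟩
      topEntries T
    ∎
    where
    open ≡-Reasoning
    sorted : Sorted (concat (tabulate (elems ∘ A)))
    sorted = AllPairsP.concat⁺ (AllP.tabulate⁺ (Sorted-elems ∘ A))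
                               (AllPairsP.tabulate⁺-< (proj₁ ∘ columns-increasing))
    ⊆top : ∀ {v} → v ∈ concat (tabulate (elems ∘ A)) → v ∈ topEntries T
    ⊆top v∈ with ∈-concat-tabulate⁻ (elems ∘ A) v∈
    ... | c , v∈A with ∈-elems⁻ (A c) v∈A
    ...   | z , z∈ , refl = ∈-elems⁺ (∈-⋃-toList⁺ (top T) c z∈)
    ⊇top : ∀ {v} → v ∈ topEntries T → v ∈ concat (tabulate (elems ∘ A))
    ⊇top v∈ with ∈-elems⁻ (⋃ (Vec.toList (top T))) v∈
    ... | z , z∈ , refl with ∈-⋃-toList⁻ (top T) z∈
    ...   | c , z∈A = ∈-concat-tabulate⁺ (elems ∘ A) c (∈-elems⁺ z∈A)

  ∈-columnWord⇒cell : ∀ c {v} → v ∈ columnWord (column c) → ∃ λ r → ∃ λ z → z ∈ₛ cell T r c × v ≡ entry z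
  ∈-columnWord⇒cell c v∈ with ∈-columnWord⁻ (elems (A c)) (B′ T c) v∈
  ... | inj₁ v∈A = let (z , z∈ , v≡) = ∈-elems⁻ (A c) v∈A in F.zero , z , z∈ , v≡
  ... | inj₂ v∈B′ = let (z , z∈ , v≡) = ∈-elems⁻ (B c) (∈B′⇒∈B c v∈B′) in F.suc F.zero , z , z∈ , v≡

  α-unique : Unique (α T)
  α-unique = subst Unique (sym α≡concat)
    (UniqueP.concat⁺ (AllP.tabulate⁺ (λ c → Unique-columnWord (column c) (column-increasing c)))
                     (AllPairsP.tabulate⁺ columns-disjoint))
    where
    columns-disjoint : ∀ {i j} → i ≢ j → Disjoint (columnWord (column i)) (columnWord (column j))
    columns-disjoint {i} {j} i≢j (v∈i , v∈j)
      with ∈-columnWord⇒cell i v∈i | ∈-columnWord⇒cell j v∈j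
    ... | r , z , z∈ , v≡ | r′ , z′ , z′∈ , v≡′ with entry-injective {z = z} {z′} (trans (sym v≡) v≡′)
    ...   | refl = i≢j (proj₂ (disjoint z r i r′ j z∈ z′∈))

  toℕ<m : ∀ {z} → z ≢ largest → toℕ z < m
  toℕ<m {z} z≢ = ≤∧≢⇒< (FinP.toℕ≤pred[n] z) (λ e → z≢ (FinP.toℕ-injective (trans e (sym (FinP.toℕ-fromℕ m)))))

  α⊆[n-1] : ∀ {v} → v ∈ α T → v ∈ applyUpTo suc m
  α⊆[n-1] v∈ with ∈-concat-tabulate⁻ (columnWord ∘ column) (subst (_ ∈_) α≡concat v∈)
  ... | c , v∈c with ∈-columnWord⁻ (elems (A c)) (B′ T c) v∈c
  ...   | inj₁ v∈A with ∈-elems⁻ (A c) v∈A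
  ...     | z , z∈ , refl = ∈P.∈-applyUpTo⁺ suc (toℕ<m λ z≡ → largest∉A c (subst (_∈ₛ A c) z≡ z∈))
  α⊆[n-1] v∈ | c , _ | inj₂ v∈B′ with ∈-elems⁻ (B c) (∈B′⇒∈B c v∈B′)
  ...     | z , z∈ , refl = ∈P.∈-applyUpTo⁺ suc (toℕ<m λ z≡ → ∈B′⇒≢n c v∈B′ (trans (cong entry z≡) entry-largest))

  [n-1]⊆α : ∀ {v} → v ∈ applyUpTo suc m → v ∈ α T
  [n-1]⊆α v∈ with ∈P.∈-applyUpTo⁻ suc v∈
  ... | i , i<m , refl = subst (_ ∈_) (sym α≡concat) (in-column (covers z))
    where
    z : Fin (suc m)
    z = F.fromℕ< (m<n⇒m<1+n i<m)
    entry-z : entry z ≡ suc i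
    entry-z = cong suc (FinP.toℕ-fromℕ< (m<n⇒m<1+n i<m))
    in-column : (∃ λ r → ∃ λ c → z ∈ₛ cell T r c) → suc i ∈ concat (tabulate (columnWord ∘ column))
    in-column (F.zero , c , z∈) = ∈-concat-tabulate⁺ (columnWord ∘ column) c
      (∈-columnWord⁺ (elems (A c)) (B′ T c) (inj₁ (subst (_∈ elems (A c)) entry-z (∈-elems⁺ z∈))))
    in-column (F.suc F.zero , c , z∈) with ∈B⇒∈B′⊎n c (subst (_∈ elems (B c)) entry-z (∈-elems⁺ z∈))
    ... | inj₁ v∈B′ = ∈-concat-tabulate⁺ (columnWord ∘ column) c (∈-columnWord⁺ (elems (A c)) (B′ T c) (inj₂ v∈B′))
    ... | inj₂ (i+1≡n , _) = ⊥-elim (<-irrefl (suc-injective i+1≡n) i<m)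

  α-isPerm : IsPerm (suc m ∸ 1) (α T)
  α-isPerm = unique-↭ α-unique (UniqueP.applyUpTo⁺₁ suc m (λ i<j _ → <⇒≢ i<j ∘ suc-injective)) α⊆[n-1] [n-1]⊆α

  parse-label-α : parse (label (α T)) ≡ columns
  parse-label-α = begin
      parse (label (α T))
    ≡⟨ cong (parse ∘ label) α≡letters ⟩
      parse (label (letters (labelColumns columns)))
    ≡⟨ cong parse (label-letters _ wellLabelled) ⟩
      parse (labelColumns columns)
    ≡⟨ parse-labelColumns columns shaped ⟩
      columns
    ∎
    where open ≡-Reasoning

tabulate-injective : ∀ {A : Set} {k} (f g : Fin k → A) → tabulate f ≡ tabulate g → ∀ i → f i ≡ g i
tabulate-injective {k = suc k} f g eq F.zero = proj₁ (∷-injective eq)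
tabulate-injective {k = suc k} f g eq (F.suc i) = tabulate-injective (f ∘ F.suc) (g ∘ F.suc) (proj₂ (∷-injective eq)) i

Vec-≡ : ∀ {A : Set} {k} (u v : Vec A k) → (∀ i → Vec.lookup u i ≡ Vec.lookup v i) → u ≡ v
Vec-≡ u v same = trans (sym (VecP.tabulate∘lookup u)) (trans (VecP.tabulate-cong same) (VecP.tabulate∘lookup v))

module _ {m b k : ℕ} {top bot top′ bot′ : Vec (Subset (suc m)) b}
         (S : IsSYT (mkTab b k top bot)) (S′ : IsSYT (mkTab b k top′ bot′)) where
  private
    module T₁ = FromTableau (mkTab b k top bot) S
    module T₂ = FromTableau (mkTab b k top′ bot′) S′

  -- a bottom cell is determined by B′ and by whether it is the last one (which also holds n)
  bottom-⊆ : (∀ c → B′ (mkTab b k top bot) c ≡ B′ (mkTab b k top′ bot′) c) →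
    ∀ c {z} → z ∈ₛ Vec.lookup bot c → z ∈ₛ Vec.lookup bot′ c
  bottom-⊆ same c z∈ =
    ∈-elems⇒∈ₛ (T₂.∈B′⊎n⇒∈B c (Sum.map₁ (subst (_ ∈_) (same c)) (T₁.∈B⇒∈B′⊎n c (∈-elems⁺ z∈))))

columns-injective : ∀ {m} (T T′ : Tab (suc m)) (S : IsSYT T) (S′ : IsSYT T′) →
  FromTableau.columns T S ≡ FromTableau.columns T′ S′ → T ≡ T′
columns-injective (mkTab b k top bot) (mkTab b′ k′ top′ bot′) S S′ eq
  with trans (sym (length-tabulate (FromTableau.column _ S))) (trans (cong length eq) (length-tabulate (FromTableau.column _ S′)))
... | refl with +-cancelˡ-≡ (2 * b) k k′ (trans (IsSYT.size S) (sym (IsSYT.size S′)))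
... | refl = cong₂ (mkTab b k) (Vec-≡ top top′ same-top) (Vec-≡ bot bot′ same-bottom)
  where
  same-column : ∀ c → FromTableau.column _ S c ≡ FromTableau.column _ S′ c
  same-column = tabulate-injective _ _ eq
  same-top : ∀ c → Vec.lookup top c ≡ Vec.lookup top′ c
  same-top c = elems-injective (cong proj₁ (same-column c))
  same-bottom : ∀ c → Vec.lookup bot c ≡ Vec.lookup bot′ c
  same-bottom c = SubsetP.⊆-antisym (bottom-⊆ S S′ (cong proj₂ ∘ same-column) c)
                                    (bottom-⊆ S′ S (sym ∘ cong proj₂ ∘ same-column) c)

α-injective : ∀ {m} (T T′ : Tab (suc m)) (S : IsSYT T) (S′ : IsSYT T′) → α T ≡ α T′ → T ≡ T′
α-injective T T′ S S′ eq = columns-injective T T′ S S′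
  (trans (sym (FromTableau.parse-label-α T S)) (trans (cong (parse ∘ label) eq) (FromTableau.parse-label-α T′ S′)))

-- From words to tableaux

label-endsInTop : ∀ xs → EmptyOrEndsInTop (label xs)
label-endsInTop [] = tt
label-endsInTop (x ∷ []) = refl
label-endsInTop (x ∷ y ∷ ys) = label-endsInTop (y ∷ ys)

AllPairs-lookup : ∀ {A : Set} {R : A → A → Set} {xs : List A} → AllPairs R xs →
  ∀ {i j} → i F.< j → R (lookup xs i) (lookup xs j)
AllPairs-lookup (h ∷ _) {F.zero} {F.suc j} _ = All.lookup h (∈P.∈-lookup j)
AllPairs-lookup (_ ∷ hs) {F.suc i} {F.suc j} i<j = AllPairs-lookup hs (s<s⁻¹ i<j)

Unique-concat-tabulate : ∀ {k} (f : Fin k → List ℕ) → Unique (concat (tabulate f)) →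
  ∀ {v} i j → v ∈ f i → v ∈ f j → i ≡ j
Unique-concat-tabulate f u F.zero F.zero _ _ = refl
Unique-concat-tabulate f u F.zero (F.suc j) v∈i v∈j =
  ⊥-elim (All.lookup (All.lookup (proj₂ (proj₂ (AllPairs-++⁻ (f F.zero) u))) v∈i)
                     (∈-concat-tabulate⁺ (f ∘ F.suc) j v∈j) refl)
Unique-concat-tabulate f u (F.suc i) F.zero v∈i v∈j = sym (Unique-concat-tabulate f u F.zero (F.suc i) v∈j v∈i)
Unique-concat-tabulate f u (F.suc i) (F.suc j) v∈i v∈j =
  cong F.suc (Unique-concat-tabulate (f ∘ F.suc) (proj₁ (proj₂ (AllPairs-++⁻ (f F.zero) u))) i j v∈i v∈j)

Shaped-bottoms : ∀ cs → Shaped cs → ∀ c → suc (toℕ c) ≢ length cs → NonEmpty (proj₂ (lookup cs c))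
Shaped-bottoms ((a , b) ∷ []) _ F.zero not-last = ⊥-elim (not-last refl)
Shaped-bottoms ((a , b) ∷ c′ ∷ cs) (_ , ne , _) F.zero _ = ne
Shaped-bottoms ((a , b) ∷ c′ ∷ cs) (_ , _ , shaped) (F.suc c) not-last =
  Shaped-bottoms (c′ ∷ cs) shaped c (not-last ∘ cong suc)

length-columnWord : ∀ a b → length (columnWord (a , b)) ≡ length a + length b
length-columnWord a b = trans (↭P.↭-length (columnWord-↭ a b)) (length-++ a)

NonEmpty⇒1≤length : ∀ xs → NonEmpty xs → 1 ≤ length xs
NonEmpty⇒1≤length (_ ∷ _) _ = s≤s z≤n

-- each column but the last carries at least two entries, the last at least one
twice-length≤ : ∀ cs → Shaped cs → length cs + length cs ≤ suc (length (concat (map columnWord cs)))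
twice-length≤ [] _ = z≤n
twice-length≤ ((a , b) ∷ []) ne = s≤s (begin
    1
  ≤⟨ m≤m+n 1 (length b) ⟩
    1 + length b
  ≤⟨ +-monoˡ-≤ (length b) (NonEmpty⇒1≤length a ne) ⟩
    length a + length b
  ≡⟨ sym (length-columnWord a b) ⟩
    length (columnWord (a , b))
  ≡⟨ sym (cong length (++-identityʳ (columnWord (a , b)))) ⟩
    length (columnWord (a , b) ++ [])
  ∎)
  where open ≤-Reasoning
twice-length≤ ((a , b) ∷ c ∷ cs) (ne-a , ne-b , shaped) = begin
    suc (length (c ∷ cs)) + suc (length (c ∷ cs))
  ≡⟨ cong suc (+-suc (length (c ∷ cs)) (length (c ∷ cs))) ⟩
    2 + (length (c ∷ cs) + length (c ∷ cs))
  ≤⟨ +-monoʳ-≤ 2 (twice-length≤ (c ∷ cs) shaped) ⟩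
    2 + suc (length rest)
  ≤⟨ +-monoˡ-≤ (suc (length rest)) (+-mono-≤ (NonEmpty⇒1≤length a ne-a) (NonEmpty⇒1≤length b ne-b)) ⟩
    length a + length b + suc (length rest)
  ≡⟨ cong (_+ suc (length rest)) (sym (length-columnWord a b)) ⟩
    length (columnWord (a , b)) + suc (length rest)
  ≡⟨ +-suc _ _ ⟩
    suc (length (columnWord (a , b)) + length rest)
  ≡⟨ cong suc (sym (length-++ (columnWord (a , b)))) ⟩
    suc (length (columnWord (a , b) ++ rest))
  ∎
  where
  open ≤-Reasoning
  rest : List ℕ
  rest = concat (map columnWord (c ∷ cs))

lastIndex : ∀ {A : Set} (xs : List A) → 1 ≤ length xs → ∃ λ (c : Fin (length xs)) → suc (toℕ c) ≡ length xs
lastIndex (x ∷ xs) _ = F.fromℕ (length xs) , cong suc (FinP.toℕ-fromℕ (length xs))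

module ToTableau {m : ℕ} (m≥1 : 1 ≤ m) (w : List ℕ) (w↭ : w ↭ applyUpTo suc m) (avoids : Avoids321 w) where

  w-unique : Unique w
  w-unique = Unique-resp-↭ (↭-sym w↭) (UniqueP.applyUpTo⁺₁ suc m (λ i<j _ → <⇒≢ i<j ∘ suc-injective))

  ∈w⁻ : ∀ {v} → v ∈ w → ∃ λ i → i < m × v ≡ suc i
  ∈w⁻ v∈ = ∈P.∈-applyUpTo⁻ suc (↭P.∈-resp-↭ w↭ v∈)

  ∈w⁺ : ∀ {i} → i < m → suc i ∈ w
  ∈w⁺ i<m = ↭P.∈-resp-↭ (↭-sym w↭) (∈P.∈-applyUpTo⁺ suc i<m)

  ∈w⇒<n : ∀ {v} → v ∈ w → v < suc m
  ∈w⇒<n v∈ with ∈w⁻ v∈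
  ... | i , i<m , refl = s≤s i<m

  ∈w⇒IsEntry : ∀ {v} → v ∈ w → IsEntry {suc m} v
  ∈w⇒IsEntry v∈ with ∈w⁻ v∈
  ... | i , i<m , refl = F.fromℕ< (m<n⇒m<1+n i<m) , sym (cong suc (FinP.toℕ-fromℕ< (m<n⇒m<1+n i<m)))

  n-IsEntry : IsEntry {suc m} (suc m)
  n-IsEntry = F.fromℕ m , sym (cong suc (FinP.toℕ-fromℕ m))

  columns : List Column
  columns = parse (label w)

  labelColumns-columns : labelColumns columns ≡ label w
  labelColumns-columns = labelColumns-parse (label w) (label-endsInTop w)

  shaped : Shaped columns
  shaped = Shaped-parse (label w) (label-endsInTop w)

  standard : Standard columns
  standard = standard-labelColumns columns
    (subst WellLabelled (sym labelColumns-columns) (label-wellLabelled w w-unique avoids))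
    (Shaped-tops columns shaped)

  b₀ : ℕ
  b₀ = length columns

  topCell bottom′ : Fin b₀ → List ℕ
  topCell c = proj₁ (lookup columns c)
  bottom′ c = proj₂ (lookup columns c)

  concat-map-columnWords : concat (map columnWord columns) ≡ w
  concat-map-columnWords = begin
      concat (map columnWord columns)
    ≡⟨ sym (letters-labelColumns columns) ⟩
      letters (labelColumns columns)
    ≡⟨ cong letters labelColumns-columns ⟩
      letters (label w)
    ≡⟨ letters-label w ⟩
      w
    ∎
    where open ≡-Reasoning

  concat-columnWords : concat (tabulate (columnWord ∘ lookup columns)) ≡ w
  concat-columnWords = trans (cong concat (trans (sym (map-tabulate (lookup columns) columnWord))
                                                 (cong (map columnWord) (tabulate-lookup columns))))
                             concat-map-columnWords

  ∈column⇒∈w : ∀ c {v} → v ∈ columnWord (lookup columns c) → v ∈ w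
  ∈column⇒∈w c v∈ = subst (_ ∈_) concat-columnWords (∈-concat-tabulate⁺ (columnWord ∘ lookup columns) c v∈)

  ∈top⇒∈w : ∀ c {v} → v ∈ topCell c → v ∈ w
  ∈top⇒∈w c v∈ = ∈column⇒∈w c (∈-columnWord⁺ (topCell c) (bottom′ c) (inj₁ v∈))

  ∈bottom′⇒∈w : ∀ c {v} → v ∈ bottom′ c → v ∈ w
  ∈bottom′⇒∈w c v∈ = ∈column⇒∈w c (∈-columnWord⁺ (topCell c) (bottom′ c) (inj₂ v∈))

  same-column : ∀ {v} c c′ → v ∈ columnWord (lookup columns c) → v ∈ columnWord (lookup columns c′) → c ≡ c′
  same-column = Unique-concat-tabulate (columnWord ∘ lookup columns) (subst Unique (sym concat-columnWords) w-unique)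

  IsLast : Fin b₀ → Set
  IsLast c = suc (toℕ c) ≡ b₀

  last-unique : ∀ {c c′} → IsLast c → IsLast c′ → c ≡ c′
  last-unique last last′ = FinP.toℕ-injective (suc-injective (trans last (sym last′)))

  last-maximal : ∀ {c c′} → IsLast c → ¬ (c F.< c′)
  last-maximal {c} {c′} last c<c′ = <-irrefl refl (<-≤-trans (FinP.toℕ<n c′) (subst (_≤ toℕ c′) last c<c′))

  -- the entry n, removed from the last bottom cell by α, is put back
  nIfLast : Fin b₀ → List ℕ
  nIfLast c with suc (toℕ c) ≟ b₀
  ... | yes _ = [ suc m ]
  ... | no _ = []

  nIfLast-last : ∀ c → IsLast c → nIfLast c ≡ [ suc m ]
  nIfLast-last c last with suc (toℕ c) ≟ b₀
  ... | yes _ = refl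
  ... | no ¬last = ⊥-elim (¬last last)

  nIfLast-notLast : ∀ c → ¬ IsLast c → nIfLast c ≡ []
  nIfLast-notLast c ¬last with suc (toℕ c) ≟ b₀
  ... | yes last = ⊥-elim (¬last last)
  ... | no _ = refl

  ∈nIfLast⁻ : ∀ c {v} → v ∈ nIfLast c → v ≡ suc m × IsLast c
  ∈nIfLast⁻ c v∈ with suc (toℕ c) ≟ b₀
  ∈nIfLast⁻ c (here refl) | yes last = refl , last

  bottomCell : Fin b₀ → List ℕ
  bottomCell c = bottom′ c ++ nIfLast c

  ∈bottomCell⁻ : ∀ c {v} → v ∈ bottomCell c → v ∈ bottom′ c ⊎ (v ≡ suc m × IsLast c)
  ∈bottomCell⁻ c v∈ with ∈P.∈-++⁻ (bottom′ c) v∈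
  ... | inj₁ v∈B′ = inj₁ v∈B′
  ... | inj₂ v∈n = inj₂ (∈nIfLast⁻ c v∈n)

  T₀ : Tab (suc m)
  T₀ = mkTab b₀ (suc m ∸ 2 * b₀) (Vec.tabulate (fromList ∘ topCell)) (Vec.tabulate (fromList ∘ bottomCell))

  column-increasing : ∀ c → IncreasingColumn (lookup columns c)
  column-increasing c = All.lookup (proj₁ standard) (∈P.∈-lookup c)

  columns-increasing : ∀ {i j} → i F.< j → IncreasingColumns (lookup columns i) (lookup columns j)
  columns-increasing = AllPairs-lookup (proj₂ standard)

  bottomCell-sorted : ∀ c → Sorted (bottomCell c)
  bottomCell-sorted c with suc (toℕ c) ≟ b₀
  ... | yes _ = AllPairsP.++⁺ (proj₁ (proj₂ (column-increasing c))) ([] ∷ [])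
                              (All.tabulate (λ v∈ → ∈w⇒<n (∈bottom′⇒∈w c v∈) ∷ []))
  ... | no _ = subst Sorted (sym (++-identityʳ (bottom′ c))) (proj₁ (proj₂ (column-increasing c)))

  topCell-entries : ∀ c → All IsEntry (topCell c)
  topCell-entries c = All.tabulate (∈w⇒IsEntry ∘ ∈top⇒∈w c)

  bottomCell-entries : ∀ c → All IsEntry (bottomCell c)
  bottomCell-entries c = All.tabulate (λ v∈ →
    [ ∈w⇒IsEntry ∘ ∈bottom′⇒∈w c , (λ { (refl , _) → n-IsEntry }) ]′ (∈bottomCell⁻ c v∈))

  ∈top⁻ : ∀ c {z} → z ∈ₛ cell T₀ F.zero c → entry z ∈ topCell c
  ∈top⁻ c z∈ = ∈-fromList⁻ (subst (_ ∈ₛ_) (VecP.lookup∘tabulate (fromList ∘ topCell) c) z∈)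

  ∈top⁺ : ∀ c {z} → entry z ∈ topCell c → z ∈ₛ cell T₀ F.zero c
  ∈top⁺ c v∈ = subst (_ ∈ₛ_) (sym (VecP.lookup∘tabulate (fromList ∘ topCell) c)) (∈-fromList⁺ v∈)

  ∈bottom⁻ : ∀ c {z} → z ∈ₛ cell T₀ (F.suc F.zero) c → entry z ∈ bottomCell c
  ∈bottom⁻ c z∈ = ∈-fromList⁻ (subst (_ ∈ₛ_) (VecP.lookup∘tabulate (fromList ∘ bottomCell) c) z∈)

  ∈bottom⁺ : ∀ c {z} → entry z ∈ bottomCell c → z ∈ₛ cell T₀ (F.suc F.zero) c
  ∈bottom⁺ c v∈ = subst (_ ∈ₛ_) (sym (VecP.lookup∘tabulate (fromList ∘ bottomCell) c)) (∈-fromList⁺ v∈)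

  elems-top : ∀ c → elems (Vec.lookup (top T₀) c) ≡ topCell c
  elems-top c = trans (cong elems (VecP.lookup∘tabulate (fromList ∘ topCell) c))
                      (elems-fromList (topCell c) (proj₁ (column-increasing c)) (topCell-entries c))

  elems-bottom : ∀ c → elems (Vec.lookup (bot T₀) c) ≡ bottomCell c
  elems-bottom c = trans (cong elems (VecP.lookup∘tabulate (fromList ∘ bottomCell) c))
                         (elems-fromList (bottomCell c) (bottomCell-sorted c) (bottomCell-entries c))

  filter-≢n : ∀ xs → All (_≢ suc m) xs → filter (λ v → ¬? (v ≟ suc m)) (xs ++ [ suc m ]) ≡ xs
  filter-≢n [] [] = filter-reject (λ v → ¬? (v ≟ suc m)) (λ v≢v → v≢v refl)
  filter-≢n (x ∷ xs) (x≢n ∷ xs≢n) = trans (filter-accept (λ v → ¬? (v ≟ suc m)) x≢n) (cong (x ∷_) (filter-≢n xs xs≢n))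

  B′-T₀ : ∀ c → B′ T₀ c ≡ bottom′ c
  B′-T₀ c with suc (toℕ c) ≟ b₀
  ... | yes last = trans (cong (filter (λ v → ¬? (v ≟ suc m))) (elems-bottom c))
                     (trans (cong (λ l → filter (λ v → ¬? (v ≟ suc m)) (bottom′ c ++ l)) (nIfLast-last c last))
                            (filter-≢n (bottom′ c) (All.tabulate (<⇒≢ ∘ ∈w⇒<n ∘ ∈bottom′⇒∈w c))))
  ... | no ¬last = trans (elems-bottom c) (trans (cong (bottom′ c ++_) (nIfLast-notLast c ¬last)) (++-identityʳ (bottom′ c)))

  α-T₀ : α T₀ ≡ w
  α-T₀ = trans (cong concat (trans (map-tabulate (λ c → c) _) (tabulate-cong same-columnWord))) concat-columnWords
    where
    same-columnWord : ∀ c → columnWord (elems (Vec.lookup (top T₀) c) , B′ T₀ c) ≡ columnWord (lookup columns c)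
    same-columnWord c = cong₂ (λ a b → columnWord (a , b)) (elems-top c) (B′-T₀ c)

  ∈top⇒∈column : ∀ c {z} → z ∈ₛ cell T₀ F.zero c → entry z ∈ columnWord (lookup columns c)
  ∈top⇒∈column c z∈ = ∈-columnWord⁺ (topCell c) (bottom′ c) (inj₁ (∈top⁻ c z∈))

  ∈bottom′⇒∈column : ∀ c {v} → v ∈ bottom′ c → v ∈ columnWord (lookup columns c)
  ∈bottom′⇒∈column c v∈ = ∈-columnWord⁺ (topCell c) (bottom′ c) (inj₂ v∈)

  ∈bottom-cases : ∀ c {z} → z ∈ₛ cell T₀ (F.suc F.zero) c → entry z ∈ bottom′ c ⊎ (entry z ≡ suc m × IsLast c)
  ∈bottom-cases c z∈ = ∈bottomCell⁻ c (∈bottom⁻ c z∈)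

  ∈w⇒≢n : ∀ {v} → v ∈ w → v ≢ suc m
  ∈w⇒≢n v∈ = <⇒≢ (∈w⇒<n v∈)

  top-bottom-disjoint : ∀ c c′ {z} → z ∈ₛ cell T₀ F.zero c → z ∈ₛ cell T₀ (F.suc F.zero) c′ → ⊥
  top-bottom-disjoint c c′ z∈ z∈′ with ∈bottom-cases c′ z∈′
  ... | inj₂ (z≡n , _) = ∈w⇒≢n (∈top⇒∈w c (∈top⁻ c z∈)) z≡n
  ... | inj₁ v∈B′ with same-column c c′ (∈top⇒∈column c z∈) (∈bottom′⇒∈column c′ v∈B′)
  ...   | refl = <-irrefl refl (All.lookup (All.lookup (proj₂ (proj₂ (column-increasing c))) (∈top⁻ c z∈)) v∈B′)

  bottom-bottom-same : ∀ c c′ {z} → z ∈ₛ cell T₀ (F.suc F.zero) c → z ∈ₛ cell T₀ (F.suc F.zero) c′ → c ≡ c′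
  bottom-bottom-same c c′ z∈ z∈′ with ∈bottom-cases c z∈ | ∈bottom-cases c′ z∈′
  ... | inj₁ v∈ | inj₁ v∈′ = same-column c c′ (∈bottom′⇒∈column c v∈) (∈bottom′⇒∈column c′ v∈′)
  ... | inj₁ v∈ | inj₂ (z≡n , _) = ⊥-elim (∈w⇒≢n (∈bottom′⇒∈w c v∈) z≡n)
  ... | inj₂ (z≡n , _) | inj₁ v∈′ = ⊥-elim (∈w⇒≢n (∈bottom′⇒∈w c′ v∈′) z≡n)
  ... | inj₂ (_ , last) | inj₂ (_ , last′) = last-unique last last′

  disjoint₀ : ∀ z r c r′ c′ → z ∈ₛ cell T₀ r c → z ∈ₛ cell T₀ r′ c′ → (r ≡ r′) × (c ≡ c′)
  disjoint₀ z F.zero c F.zero c′ z∈ z∈′ = refl , same-column c c′ (∈top⇒∈column c z∈) (∈top⇒∈column c′ z∈′)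
  disjoint₀ z F.zero c (F.suc F.zero) c′ z∈ z∈′ = ⊥-elim (top-bottom-disjoint c c′ z∈ z∈′)
  disjoint₀ z (F.suc F.zero) c F.zero c′ z∈ z∈′ = ⊥-elim (top-bottom-disjoint c′ c z∈′ z∈)
  disjoint₀ z (F.suc F.zero) c (F.suc F.zero) c′ z∈ z∈′ = refl , bottom-bottom-same c c′ z∈ z∈′

  entries-increasing₀ : ∀ r c r′ c′ → r F.≤ r′ → c ≡ c′ ⊎ c F.< c′ → ¬ ((r ≡ r′) × (c ≡ c′)) →
    ∀ {x y} → x ∈ₛ cell T₀ r c → y ∈ₛ cell T₀ r′ c′ → entry x < entry y
  entries-increasing₀ F.zero c F.zero c′ _ (inj₁ refl) distinct _ _ = ⊥-elim (distinct (refl , refl))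
  entries-increasing₀ F.zero c F.zero c′ _ (inj₂ c<c′) _ x∈ y∈ =
    All.lookup (All.lookup (proj₁ (columns-increasing c<c′)) (∈top⁻ c x∈)) (∈top⁻ c′ y∈)
  entries-increasing₀ F.zero c (F.suc F.zero) c′ _ c≤c′ _ {x} x∈ y∈ with ∈bottom-cases c′ y∈
  ... | inj₂ (y≡n , _) = subst (entry x <_) (sym y≡n) (∈w⇒<n (∈top⇒∈w c (∈top⁻ c x∈)))
  ... | inj₁ y∈B′ with c≤c′
  ...   | inj₁ refl = All.lookup (All.lookup (proj₂ (proj₂ (column-increasing c))) (∈top⁻ c x∈)) y∈B′
  ...   | inj₂ c<c′ = All.lookup (All.lookup (proj₁ (proj₂ (columns-increasing c<c′))) (∈top⁻ c x∈)) y∈B′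
  entries-increasing₀ (F.suc F.zero) c (F.suc F.zero) c′ _ (inj₁ refl) distinct _ _ = ⊥-elim (distinct (refl , refl))
  entries-increasing₀ (F.suc F.zero) c (F.suc F.zero) c′ _ (inj₂ c<c′) _ {x} x∈ y∈
    with ∈bottom-cases c x∈ | ∈bottom-cases c′ y∈
  ... | inj₂ (_ , last) | _ = ⊥-elim (last-maximal last c<c′)
  ... | inj₁ x∈B′ | inj₁ y∈B′ = All.lookup (All.lookup (proj₂ (proj₂ (columns-increasing c<c′))) x∈B′) y∈B′
  ... | inj₁ x∈B′ | inj₂ (y≡n , _) = subst (entry x <_) (sym y≡n) (∈w⇒<n (∈bottom′⇒∈w c x∈B′))

  increasing₀ : ∀ r c r′ c′ → r F.≤ r′ → c F.≤ c′ → ¬ ((r ≡ r′) × (c ≡ c′)) →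
    ∀ (x y : Fin (suc m)) → x ∈ₛ cell T₀ r c → y ∈ₛ cell T₀ r′ c′ → x F.< y
  increasing₀ r c r′ c′ r≤r′ c≤c′ distinct x y x∈ y∈ =
    s<s⁻¹ (entries-increasing₀ r c r′ c′ r≤r′ c≡⊎< distinct x∈ y∈)
    where
    c≡⊎< : c ≡ c′ ⊎ c F.< c′
    c≡⊎< with c F.≟ c′
    ... | yes c≡c′ = inj₁ c≡c′
    ... | no c≢c′ = inj₂ (FinP.≤∧≢⇒< c≤c′ c≢c′)

  b₀≥1 : 1 ≤ b₀
  b₀≥1 with columns | labelColumns-columns
  ... | _ ∷ _ | _ = s≤s z≤n
  ... | [] | []≡label = ⊥-elim (∈-[] (subst (1 ∈_) w≡[] (∈w⁺ m≥1)))
    where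
    w≡[] : w ≡ []
    w≡[] = trans (sym (letters-label w)) (cong letters (sym []≡label))
    ∈-[] : ∀ {v : ℕ} → v ∈ [] → ⊥
    ∈-[] ()

  lastColumn : ∃ IsLast
  lastColumn = lastIndex columns b₀≥1

  covers₀ : ∀ z → ∃ λ r → ∃ λ c → z ∈ₛ cell T₀ r c
  covers₀ z with toℕ z ≟ m
  ... | yes z≡m = let (c , last) = lastColumn in F.suc F.zero , c , ∈bottom⁺ c
      (∈P.∈-++⁺ʳ (bottom′ c) (subst (entry z ∈_) (sym (nIfLast-last c last)) (here (cong suc z≡m))))
  ... | no z≢m with ∈-concat-tabulate⁻ (columnWord ∘ lookup columns)
                      (subst (entry z ∈_) (sym concat-columnWords) (∈w⁺ (≤∧≢⇒< (FinP.toℕ≤pred[n] z) z≢m)))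
  ...   | c , z∈ with ∈-columnWord⁻ (topCell c) (bottom′ c) z∈
  ...     | inj₁ z∈top = F.zero , c , ∈top⁺ c z∈top
  ...     | inj₂ z∈B′ = F.suc F.zero , c , ∈bottom⁺ c (∈P.∈-++⁺ˡ z∈B′)

  nonempty₀ : ∀ r c → Nonempty (cell T₀ r c)
  nonempty₀ F.zero c = subst Nonempty (sym (VecP.lookup∘tabulate (fromList ∘ topCell) c))
    (nonempty-fromList (topCell c) (All.lookup (Shaped-tops columns shaped) (∈P.∈-lookup c)) (topCell-entries c))
  nonempty₀ (F.suc F.zero) c = subst Nonempty (sym (VecP.lookup∘tabulate (fromList ∘ bottomCell) c))
    (nonempty-fromList (bottomCell c) bottomCell-nonEmpty (bottomCell-entries c))
    where
    ++-nonEmpty : ∀ xs ys → NonEmpty xs ⊎ NonEmpty ys → NonEmpty (xs ++ ys)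
    ++-nonEmpty (_ ∷ _) ys _ = tt
    ++-nonEmpty [] ys (inj₂ ne) = ne
    bottomCell-nonEmpty : NonEmpty (bottomCell c)
    bottomCell-nonEmpty with suc (toℕ c) ≟ b₀
    ... | yes _ = ++-nonEmpty (bottom′ c) [ suc m ] (inj₂ tt)
    ... | no ¬last = ++-nonEmpty (bottom′ c) [] (inj₁ (Shaped-bottoms columns shaped c ¬last))

  2b₀≤n : 2 * b₀ ≤ suc m
  2b₀≤n = begin
      2 * b₀
    ≡⟨ cong (b₀ +_) (+-identityʳ b₀) ⟩
      b₀ + b₀
    ≤⟨ twice-length≤ columns shaped ⟩
      suc (length (concat (map columnWord columns)))
    ≡⟨ cong (suc ∘ length) concat-map-columnWords ⟩
      suc (length w)
    ≡⟨ cong suc (trans (↭P.↭-length w↭) (length-applyUpTo suc m)) ⟩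
      suc m
    ∎
    where open ≤-Reasoning

  T₀-isSYT : IsSYT T₀
  T₀-isSYT = record
    { b≥1 = b₀≥1
    ; size = m+[n∸m]≡n 2b₀≤n
    ; nonempty = nonempty₀
    ; covers = covers₀
    ; disjoint = disjoint₀
    ; increasing = increasing₀
    }

theorem7 : (n : ℕ) → 2 ≤ n →
    ((T : Tab n) → IsSYT T → IsPerm (n ∸ 1) (α T) × Avoids321 (α T))
    × ((T T′ : Tab n) → IsSYT T → IsSYT T′ → α T ≡ α T′ → T ≡ T′)
    × ((w : List ℕ) → IsPerm (n ∸ 1) w → Avoids321 w →
       Σ (Tab n) λ T → IsSYT T × (α T ≡ w))
    × ((T : Tab n) → IsSYT T → rlMins (α T) ≡ topEntries T)
    × ((T : Tab n) → IsSYT T → innerValleys (α T) ≡ b T ∸ 1)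
theorem7 (suc m) (s≤s m≥1) =
  (λ T S → FromTableau.α-isPerm T S , FromTableau.α-avoids321 T S) ,
  α-injective ,
  (λ w w↭ avoids → let open ToTableau m≥1 w w↭ avoids in T₀ , T₀-isSYT , α-T₀) ,
  FromTableau.α-rlMins ,
  FromTableau.α-innerValleys
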